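{- If a series–parallel graph $G$ contains $R_{3,3}$ as a substructure, then $G$ is not minimally $\frac12$-tough.
   Context: All graphs are finite and undirected; parallel edges allowed. For a graph $H$, $c(H)$ denotes its number of components. A set $S\subseteq V(G)$ is a cutset if $c(G-S)>1$. $G$ is $t$-tough if $|S|\ge t\cdot c(G-S)$ for every cutset $S$; $\tau(G)$ is the largest such $t$, with $\tau(K_n)=\infty$. $G$ is minimally $t$-tough if $\tau(G)=t$ and $\tau(G-e)<t$ for every edge $e$. A series–parallel graph $G(s,t)$ with terminals $s,t$ is either a single edge $st$, or is obtained from series–parallel graphs $G_1(s_1,t_1),\dots,G_k(s_k,t_k)$, $k\ge 2$, by a series join (identify $t_i$ with $s_{i+1}$, set $s=s_1$, $t=t_k$) or a parallel join (identify all $s_i$ into $s$ and all $t_i$ into $t$). The construction gives a rooted ordered tree $T_G$ (sp-tree): leaves are edges, internal nodes are series or parallel joins (children ordered as joined), with series and parallel nodes alternating along root-to-leaf paths. A substructure of $T_G$ rooted at a node $x$ consists of $x$ together with some of its children (consecutive ones if $x$ is a series node) and the complete subtrees below those children; only the root of a substructure may have further children not in it. $P_2$ is a series node with exactly two edge children. For $i\ge2$, $R_i$ is a parallel node with exactly $i$ children, each a $P_2$; $R_1$ is a single edge. For $i,j\ge 1$, $R_{i,j}$ is the substructure consisting of a series node having, as two consecutive children (in this order), an $R_i$ and an $R_j$ (the series join of $R_i$ and $R_j$). $G$ contains $R_{3,3}$ if $T_G$ has a substructure of this form. -}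

module Defs where

open import Data.Nat as ℕ using (ℕ; zero; suc; _+_; _∸_)
open import Data.Integer using (+_)
open import Data.Rational using (ℚ; _/_; _*_; _≤_; _<_)
open import Data.Fin using (Fin; toℕ)
open import Data.Fin.Subset using (Subset; _∉_; ∣_∣)
open import Data.List using (List; []; _∷_; _++_; length; map; removeAt)
open import Data.List.Membership.Propositional using (_∈_)
open import Data.List.Relation.Unary.All using (All)
open import Data.Product using (Σ; ∃; _×_; _,_)
open import Data.Sum using (_⊎_)
open import Data.Bool using (Bool; true; false)
open import Data.Unit using (⊤)
open import Relation.Binary.PropositionalEquality using (_≡_)
open import Relation.Nullary using (¬_)
open import Function.Bundles using (_⇔_)

-- Finite multigraphs.  Vertices are 0 … nV-1 (i.e. Fin nV); edges are a
-- list of (unordered) pairs of vertex labels; parallel edges allowed.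

record Graph : Set where
  constructor mkGraph
  field
    nV    : ℕ
    edges : List (ℕ × ℕ)
open Graph public

Adj : (G : Graph) → Fin (nV G) → Fin (nV G) → Set
Adj G u v = ((toℕ u , toℕ v) ∈ edges G) ⊎ ((toℕ v , toℕ u) ∈ edges G)

data Conn (G : Graph) (S : Subset (nV G)) : Fin (nV G) → Fin (nV G) → Set where
  here : ∀ {u} → u ∉ S → Conn G S u u
  step : ∀ {u w v} → u ∉ S → w ∉ S → Adj G u w → Conn G S w v → Conn G S u v

-- c(G - S) = k : there is a labelling of the vertices of G - S by
-- 0 … k-1 hitting every label, with equal labels iff same component.
-- (i.e. a bijection between the components of G - S and Fin k)
NumComponents : (G : Graph) → Subset (nV G) → ℕ → Set
NumComponents G S k =
  Σ (Fin (nV G) → ℕ) λ f →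
      (∀ v → v ∉ S → f v ℕ.< k)
    × (∀ i → i ℕ.< k → ∃ λ v → v ∉ S × f v ≡ i)
    × (∀ u v → u ∉ S → v ∉ S → (f u ≡ f v) ⇔ Conn G S u v)

ℕtoℚ : ℕ → ℚ
ℕtoℚ k = + k / 1

IsTough : Graph → ℚ → Set
IsTough G t = ∀ (S : Subset (nV G)) (k : ℕ) → NumComponents G S k → 2 ℕ.≤ k →
              t * ℕtoℚ k ≤ ℕtoℚ ∣ S ∣

-- τ(G) = t : t is the largest value for which G is t-tough
-- (for complete graphs no such t exists, matching τ(K_n) = ∞)
Toughness≡ : Graph → ℚ → Set
Toughness≡ G t = IsTough G t × (∀ t′ → t < t′ → ¬ IsTough G t′)

deleteEdge : (G : Graph) → Fin (length (edges G)) → Graph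
deleteEdge G e = mkGraph (nV G) (removeAt (edges G) e)

MinimallyTough : Graph → ℚ → Set
MinimallyTough G t =
  Toughness≡ G t ×
  (∀ (e : Fin (length (edges G))) → ∃ λ t′ → t′ < t × Toughness≡ (deleteEdge G e) t′)

data SPTree : Set where
  edge : SPTree
  ser  : List SPTree → SPTree
  par  : List SPTree → SPTree

isSer : SPTree → Bool
isSer (ser _) = true
isSer _       = false

isPar : SPTree → Bool
isPar (par _) = true
isPar _       = false

mutual
  WellFormed : SPTree → Set
  WellFormed edge     = ⊤
  WellFormed (ser xs) = 2 ℕ.≤ length xs × All (λ c → isSer c ≡ false) xs × AllWF xs
  WellFormed (par xs) = 2 ℕ.≤ length xs × All (λ c → isPar c ≡ false) xs × AllWF xs

  AllWF : List SPTree → Set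
  AllWF []       = ⊤
  AllWF (x ∷ xs) = WellFormed x × AllWF xs

-- The graph G(s,t) of an sp-tree.  Encoding: a graph with terminals is
-- (n , E) with s = 0, t = 1 and the other vertices 2 … n-1.

relabel : (ℕ → ℕ) → List (ℕ × ℕ) → List (ℕ × ℕ)
relabel f = map (λ { (a , b) → (f a , f b) })

-- series join of two: s = 0, t = 1, middle vertex 2,
-- internal vertices of A at 3 …, internal vertices of B after them
serMapA : ℕ → ℕ
serMapA 0 = 0
serMapA 1 = 2
serMapA v = suc v

serMapB : ℕ → ℕ → ℕ
serMapB nA 0 = 2
serMapB nA 1 = 1
serMapB nA v = v + nA ∸ 1

ser2 : ℕ × List (ℕ × ℕ) → ℕ × List (ℕ × ℕ) → ℕ × List (ℕ × ℕ)
ser2 (nA , EA) (nB , EB) = (nA + nB ∸ 1 , relabel serMapA EA ++ relabel (serMapB nA) EB)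

-- parallel join of two: terminals shared, internal vertices of B shifted
parMapB : ℕ → ℕ → ℕ
parMapB nA 0 = 0
parMapB nA 1 = 1
parMapB nA v = v + nA ∸ 2

par2 : ℕ × List (ℕ × ℕ) → ℕ × List (ℕ × ℕ) → ℕ × List (ℕ × ℕ)
par2 (nA , EA) (nB , EB) = (nA + nB ∸ 2 , EA ++ relabel (parMapB nA) EB)

edgeG : ℕ × List (ℕ × ℕ)
edgeG = (2 , (0 , 1) ∷ [])

mutual
  build : SPTree → ℕ × List (ℕ × ℕ)
  build edge     = edgeG
  build (ser xs) = buildSer xs
  build (par xs) = buildPar xs

  buildSer : List SPTree → ℕ × List (ℕ × ℕ)
  buildSer []       = edgeG   -- never used for well-formed trees
  buildSer (x ∷ []) = build x
  buildSer (x ∷ xs@(_ ∷ _)) = ser2 (build x) (buildSer xs)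

  buildPar : List SPTree → ℕ × List (ℕ × ℕ)
  buildPar []       = edgeG   -- never used for well-formed trees
  buildPar (x ∷ []) = build x
  buildPar (x ∷ xs@(_ ∷ _)) = par2 (build x) (buildPar xs)

graphOf : SPTree → Graph
graphOf T with build T
... | (n , E) = mkGraph n E

P₂ : SPTree
P₂ = ser (edge ∷ edge ∷ [])

R₃ : SPTree
R₃ = par (P₂ ∷ P₂ ∷ P₂ ∷ [])

-- T_G has a substructure R_{3,3}: some series node of T_G has two
-- consecutive children which are (complete subtrees equal to) R₃, R₃.
data ContainsR33 : SPTree → Set where
  here  : ∀ xs ys → ContainsR33 (ser (xs ++ R₃ ∷ R₃ ∷ ys))
  inSer : ∀ {xs c} → c ∈ xs → ContainsR33 c → ContainsR33 (ser xs)
  inPar : ∀ {xs c} → c ∈ xs → ContainsR33 c → ContainsR33 (par xs)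

{-# OPTIONS --safe #-}

-- Name the vertices of the R₃,₃ s, x₁ x₂ x₃, m, y₁ y₂ y₃, t (the xᵢ and yⱼ are the middle
-- vertices of the P₂'s, m the shared terminal).  Then H = G − x₁m is still ½-tough, so G is
-- not minimally ½-tough.  ½-toughness says c(G − S) ≤ 2|S| for every cutset S; take S with
-- c(H − S) > 2|S| and |S| minimal.
--   * If x₁ ∈ S, m ∈ S, or x₁ and m lie in one component of H − S, then G − S has the same
--     components as H − S, contradicting the ½-toughness of G.
--   * If a vertex of degree two among x₂, x₃, y₁, y₂, y₃ lies in S, putting it back merges at
--     most two components, so removing it from S gives a smaller counterexample.
--   * Otherwise s ∈ S, for x₁ s x₂ m joins x₁ and m.  In G − (S ∪ {m}) the component of m in
--     H − S falls apart into x₂, x₃ and the part reached through t, or into x₂, x₃, y₁, y₂, y₃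
--     if t ∈ S.  Hence c(G − (S ∪ {m})) ≥ c(H − S) + 2 > 2 |S ∪ {m}|, contradicting the
--     ½-toughness of G.
module Submission where

open import Defs
open import Data.Nat as ℕ using (ℕ; zero; suc; _+_; _∸_; z≤n; s≤s)
import Data.Nat.Properties as ℕ
open import Data.Nat.Induction using (<-wellFounded)
import Data.Nat.Coprimality as Coprime
import Data.Integer as ℤ
import Data.Integer.Properties as ℤ
open import Data.Rational as ℚ using (½; toℚᵘ)
import Data.Rational.Properties as ℚ
import Data.Rational.Unnormalised as ℚᵘ
import Data.Rational.Unnormalised.Properties as ℚᵘ
open import Data.Fin as Fin using (Fin; toℕ; #_)
import Data.Fin.Properties as Fin
open import Data.Fin.Patterns using (0F; 1F; 2F; 3F)
open import Data.Fin.Subset using (Subset; _∈_; _∉_; ∣_∣; inside; outside; _∪_; _-_; ⁅_⁆)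
open import Data.Fin.Subset.Properties
  using (_∈?_; x∈p⇒∣p-x∣<∣p∣; ∣⁅x⁆∣≡1; p─q⊆p; x∈p∧x≢y⇒x∈p-y; x∈p∪q⁺; x∈p∪q⁻; x∈⁅x⁆; x∈⁅y⁆⇒x≡y)
open import Data.List using (List; []; _∷_; _++_; length; removeAt; lookup)
import Data.List.Properties as List
open import Data.List.Relation.Unary.All as All using (All; []; _∷_)
import Data.List.Relation.Unary.All.Properties as All
open import Data.List.Relation.Unary.Any as Any using (here; there)
open import Data.List.Relation.Unary.Any.Properties using (lookup-index)
open import Data.List.Membership.Propositional using () renaming (_∈_ to _∈ₗ_)
open import Data.List.Membership.Propositional.Properties using (∈-map⁺; ∈-++⁺ˡ; ∈-++⁺ʳ)
open import Data.Vec using ([]; _∷_; here; there)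
open import Data.Product using (Σ; ∃; _×_; _,_; proj₁; proj₂)
open import Data.Product.Properties using (,-injectiveˡ; ,-injectiveʳ; ≡-dec)
open import Data.List.Membership.DecPropositional (≡-dec ℕ._≟_ ℕ._≟_) using () renaming (_∈?_ to _∈ₗ?_)
open import Data.Sum using (_⊎_; inj₁; inj₂)
open import Data.Empty using (⊥; ⊥-elim)
open import Data.Bool using (Bool; true; false; T; _∧_; _∨_; not; if_then_else_)
open import Data.Bool.Properties using (T-∧)
open import Data.Unit using (tt)
open import Function using (_∘_; id; case_of_)
open import Function.Bundles using (_⇔_; mk⇔; Equivalence)
import Function.Properties.Equivalence as ⇔
import Induction.WellFounded as WF
import Relation.Binary.Construct.On as On
open import Relation.Binary.PropositionalEquality
open import Relation.Nullary using (¬_; Dec; yes; no)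
open import Relation.Nullary.Decidable using (True; toWitness; from-yes; _×-dec_; _⊎-dec_; _→-dec_; ¬?; T?)

-- ½-toughness as an inequality in ℕ

toℚᵘ-ℕtoℚ : ∀ k → toℚᵘ (ℕtoℚ k) ≡ ℚᵘ.mkℚᵘ (ℤ.+ k) 0
toℚᵘ-ℕtoℚ k = cong toℚᵘ (ℚ.normalize-coprime (Coprime.sym (Coprime.1-coprimeTo k)))

½ᵘ*k≤n⇔k≤n+n : ∀ k n →
               (toℚᵘ ½ ℚᵘ.* ℚᵘ.mkℚᵘ (ℤ.+ k) 0 ℚᵘ.≤ ℚᵘ.mkℚᵘ (ℤ.+ n) 0) ⇔ (k ℕ.≤ n + n)
½ᵘ*k≤n⇔k≤n+n k n = mk⇔ (λ { (ℚᵘ.*≤* p) → ℤ.drop‿+≤+ (subst₂ ℤ._≤_ lhs rhs p) })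
                        (λ p → ℚᵘ.*≤* (subst₂ ℤ._≤_ (sym lhs) (sym rhs) (ℤ.+≤+ p)))
  where
  lhs : (ℤ.+ 1 ℤ.* ℤ.+ k) ℤ.* ℤ.+ 1 ≡ ℤ.+ k
  lhs = trans (ℤ.*-identityʳ (ℤ.+ 1 ℤ.* ℤ.+ k)) (ℤ.*-identityˡ (ℤ.+ k))
  rhs : ℤ.+ n ℤ.* ℤ.+ 2 ≡ ℤ.+ (n + n)
  rhs = trans (sym (ℤ.pos-* n 2)) (cong ℤ.+_ (trans (ℕ.*-comm n 2) (cong (n +_) (ℕ.+-identityʳ n))))

½*k≤n⇔k≤n+n : ∀ k n → (½ ℚ.* ℕtoℚ k ℚ.≤ ℕtoℚ n) ⇔ (k ℕ.≤ n + n)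
½*k≤n⇔k≤n+n k n = ⇔.trans (mk⇔ ℚ.toℚᵘ-mono-≤ ℚ.toℚᵘ-cancel-≤) (⇔.trans homo unnormalised)
  where
  homo : (toℚᵘ (½ ℚ.* ℕtoℚ k) ℚᵘ.≤ toℚᵘ (ℕtoℚ n)) ⇔
         (toℚᵘ ½ ℚᵘ.* toℚᵘ (ℕtoℚ k) ℚᵘ.≤ toℚᵘ (ℕtoℚ n))
  homo = mk⇔ (ℚᵘ.≤-respˡ-≃ (ℚ.toℚᵘ-homo-* ½ (ℕtoℚ k)))
             (ℚᵘ.≤-respˡ-≃ (ℚᵘ.≃-sym (ℚ.toℚᵘ-homo-* ½ (ℕtoℚ k))))
  unnormalised : (toℚᵘ ½ ℚᵘ.* toℚᵘ (ℕtoℚ k) ℚᵘ.≤ toℚᵘ (ℕtoℚ n)) ⇔ (k ℕ.≤ n + n)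
  unnormalised rewrite toℚᵘ-ℕtoℚ k | toℚᵘ-ℕtoℚ n = ½ᵘ*k≤n⇔k≤n+n k n

HalfTough : Graph → Set
HalfTough G = ∀ (S : Subset (nV G)) k → NumComponents G S k → 2 ℕ.≤ k → k ℕ.≤ ∣ S ∣ + ∣ S ∣

isTough½⇔halfTough : ∀ G → IsTough G ½ ⇔ HalfTough G
isTough½⇔halfTough G =
  mk⇔ (λ tough S k nc 2≤k → Equivalence.to   (½*k≤n⇔k≤n+n k ∣ S ∣) (tough S k nc 2≤k))
      (λ tough S k nc 2≤k → Equivalence.from (½*k≤n⇔k≤n+n k ∣ S ∣) (tough S k nc 2≤k))

-- Cut sets, walks and component labellings

x∉p-x : ∀ {n} (p : Subset n) x → x ∉ p - x
x∉p-x (inside  ∷ p) Fin.zero    ()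
x∉p-x (outside ∷ p) Fin.zero    ()
x∉p-x (_       ∷ p) (Fin.suc x) (there x∈p-x) = x∉p-x p x x∈p-x

∣p∪q∣≤∣p∣+∣q∣ : ∀ {n} (p q : Subset n) → ∣ p ∪ q ∣ ℕ.≤ ∣ p ∣ + ∣ q ∣
∣p∪q∣≤∣p∣+∣q∣ []            []            = z≤n
∣p∪q∣≤∣p∣+∣q∣ (outside ∷ p) (outside ∷ q) = ∣p∪q∣≤∣p∣+∣q∣ p q
∣p∪q∣≤∣p∣+∣q∣ (outside ∷ p) (inside  ∷ q) =
  subst (suc ∣ p ∪ q ∣ ℕ.≤_) (sym (ℕ.+-suc ∣ p ∣ ∣ q ∣)) (s≤s (∣p∪q∣≤∣p∣+∣q∣ p q))
∣p∪q∣≤∣p∣+∣q∣ (inside  ∷ p) (outside ∷ q) = s≤s (∣p∪q∣≤∣p∣+∣q∣ p q)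
∣p∪q∣≤∣p∣+∣q∣ (inside  ∷ p) (inside  ∷ q) =
  s≤s (ℕ.≤-trans (∣p∪q∣≤∣p∣+∣q∣ p q) (ℕ.+-monoʳ-≤ ∣ p ∣ (ℕ.n≤1+n ∣ q ∣)))

∣p∪⁅x⁆∣≤1+∣p∣ : ∀ {n} (p : Subset n) x → ∣ p ∪ ⁅ x ⁆ ∣ ℕ.≤ suc ∣ p ∣
∣p∪⁅x⁆∣≤1+∣p∣ p x = ℕ.≤-trans (∣p∪q∣≤∣p∣+∣q∣ p ⁅ x ⁆)
  (ℕ.≤-reflexive (trans (cong (∣ p ∣ +_) (∣⁅x⁆∣≡1 x)) (ℕ.+-comm ∣ p ∣ 1)))

x∉p⇒x∉p-y : ∀ {n} {p : Subset n} {x y} → x ∉ p → x ∉ p - y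
x∉p⇒x∉p-y {p = p} {y = y} x∉p x∈p-y = x∉p (p─q⊆p p ⁅ y ⁆ x∈p-y)

x∉p-y⇒x∉p : ∀ {n} {p : Subset n} {x y} → x ≢ y → x ∉ p - y → x ∉ p
x∉p-y⇒x∉p x≢y x∉p-y x∈p = x∉p-y (x∈p∧x≢y⇒x∈p-y x∈p x≢y)

x∉p∪⁅y⁆⇒x∉p : ∀ {n} {p : Subset n} {x y} → x ∉ p ∪ ⁅ y ⁆ → x ∉ p
x∉p∪⁅y⁆⇒x∉p x∉ x∈p = x∉ (x∈p∪q⁺ (inj₁ x∈p))

x∉p∪⁅y⁆⇒x≢y : ∀ {n} {p : Subset n} {x y} → x ∉ p ∪ ⁅ y ⁆ → x ≢ y
x∉p∪⁅y⁆⇒x≢y {x = x} x∉ refl = x∉ (x∈p∪q⁺ (inj₂ (x∈⁅x⁆ x)))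

x∉p∧x≢y⇒x∉p∪⁅y⁆ : ∀ {n} {p : Subset n} {x y} → x ∉ p → x ≢ y → x ∉ p ∪ ⁅ y ⁆
x∉p∧x≢y⇒x∉p∪⁅y⁆ {p = p} {y = y} x∉p x≢y x∈ with x∈p∪q⁻ p ⁅ y ⁆ x∈
... | inj₁ x∈p   = x∉p x∈p
... | inj₂ x∈⁅y⁆ = x≢y (x∈⁅y⁆⇒x≡y y x∈⁅y⁆)

module _ {A : Set} where

  ∈-removeAt⁻ : ∀ (xs : List A) i {x} → x ∈ₗ xs → x ∈ₗ removeAt xs i ⊎ x ≡ lookup xs i
  ∈-removeAt⁻ (y ∷ xs) Fin.zero    (here x≡y)  = inj₂ x≡y
  ∈-removeAt⁻ (y ∷ xs) Fin.zero    (there x∈xs) = inj₁ x∈xs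
  ∈-removeAt⁻ (y ∷ xs) (Fin.suc i) (here x≡y)  = inj₁ (here x≡y)
  ∈-removeAt⁻ (y ∷ xs) (Fin.suc i) (there x∈xs) = Data.Sum.map₁ there (∈-removeAt⁻ xs i x∈xs)

  removeAt-⊆ : ∀ (xs : List A) i {x} → x ∈ₗ removeAt xs i → x ∈ₗ xs
  removeAt-⊆ (y ∷ xs) Fin.zero    x∈          = there x∈
  removeAt-⊆ (y ∷ xs) (Fin.suc i) (here x≡y)  = here x≡y
  removeAt-⊆ (y ∷ xs) (Fin.suc i) (there x∈) = there (removeAt-⊆ xs i x∈)

module _ {G : Graph} where

  Adj-sym : ∀ {u v} → Adj G u v → Adj G v u
  Adj-sym (inj₁ e) = inj₂ e
  Adj-sym (inj₂ e) = inj₁ e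

  module _ {S : Subset (nV G)} where

    Conn-src : ∀ {u v} → Conn G S u v → u ∉ S
    Conn-src (here u∉S)       = u∉S
    Conn-src (step u∉S _ _ _) = u∉S

    Conn-tgt : ∀ {u v} → Conn G S u v → v ∉ S
    Conn-tgt (here v∉S)     = v∉S
    Conn-tgt (step _ _ _ c) = Conn-tgt c

    Conn-trans : ∀ {u v w} → Conn G S u v → Conn G S v w → Conn G S u w
    Conn-trans (here _)         d = d
    Conn-trans (step u∉ w∉ a c) d = step u∉ w∉ a (Conn-trans c d)

    Conn-edge : ∀ {u v} → u ∉ S → v ∉ S → Adj G u v → Conn G S u v
    Conn-edge u∉ v∉ a = step u∉ v∉ a (here v∉)

    Conn-sym : ∀ {u v} → Conn G S u v → Conn G S v u
    Conn-sym (here u∉)         = here u∉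
    Conn-sym (step u∉ w∉ a c) = Conn-trans (Conn-sym c) (Conn-edge w∉ u∉ (Adj-sym a))

    Conn-isolated : ∀ {u v} → (∀ {w} → Adj G u w → w ∈ S) → Conn G S u v → u ≡ v
    Conn-isolated iso (here _)         = refl
    Conn-isolated iso (step _ w∉ a _) = ⊥-elim (w∉ (iso a))

    Conn-invariant : (g : Fin (nV G) → ℕ) → (∀ {u w} → u ∉ S → w ∉ S → Adj G u w → g u ≡ g w) →
                     ∀ {u v} → Conn G S u v → g u ≡ g v
    Conn-invariant g g-edge (here _)         = refl
    Conn-invariant g g-edge (step u∉ w∉ a c) = trans (g-edge u∉ w∉ a) (Conn-invariant g g-edge c)

    module _ {k} (nc : NumComponents G S k) where

      label : Fin (nV G) → ℕ
      label = proj₁ nc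

      label< : ∀ {v} → v ∉ S → label v ℕ.< k
      label< = proj₁ (proj₂ nc) _

      label-surjective : ∀ {i} → i ℕ.< k → ∃ λ v → v ∉ S × label v ≡ i
      label-surjective = proj₁ (proj₂ (proj₂ nc)) _

      label≡⇒Conn : ∀ {u v} → u ∉ S → v ∉ S → label u ≡ label v → Conn G S u v
      label≡⇒Conn u∉ v∉ = Equivalence.to (proj₂ (proj₂ (proj₂ nc)) _ _ u∉ v∉)

      Conn⇒label≡ : ∀ {u v} → Conn G S u v → label u ≡ label v
      Conn⇒label≡ c = Equivalence.from (proj₂ (proj₂ (proj₂ nc)) _ _ (Conn-src c) (Conn-tgt c)) c

    numComponents : ∀ k (g : Fin (nV G) → ℕ) →
                    (∀ {v} → v ∉ S → g v ℕ.< k) →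
                    (∀ {i} → i ℕ.< k → ∃ λ v → v ∉ S × g v ≡ i) →
                    (∀ {u w} → u ∉ S → w ∉ S → Adj G u w → g u ≡ g w) →
                    (∀ {u w} → u ∉ S → w ∉ S → g u ≡ g w → Conn G S u w) →
                    NumComponents G S k
    numComponents k g g< g-surjective g-edge g≡⇒Conn =
      g , (λ _ → g<) , (λ _ → g-surjective) ,
      λ _ _ u∉ v∉ → mk⇔ (g≡⇒Conn u∉ v∉) (Conn-invariant g g-edge)

Conn-map : ∀ {n} {E E′ : List (ℕ × ℕ)} {S S′ : Subset n} →
           (∀ {u w} → u ∉ S → w ∉ S → Adj (mkGraph n E) u w → Conn (mkGraph n E′) S′ u w) →
           (∀ {u} → u ∉ S → u ∉ S′) →
           ∀ {u v} → Conn (mkGraph n E) S u v → Conn (mkGraph n E′) S′ u v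
Conn-map edge-map ∉-map (here u∉)         = here (∉-map u∉)
Conn-map edge-map ∉-map (step u∉ w∉ a c) = Conn-trans (edge-map u∉ w∉ a) (Conn-map edge-map ∉-map c)

-- Changing the cut set by one vertex

-- ℕ analogues of Fin.punchOut and Fin.punchIn.
punchOut : ℕ → ℕ → ℕ
punchOut zero    zero    = zero
punchOut zero    (suc x) = x
punchOut (suc b) zero    = zero
punchOut (suc b) (suc x) = suc (punchOut b x)

punchIn : ℕ → ℕ → ℕ
punchIn zero    i       = suc i
punchIn (suc b) zero    = zero
punchIn (suc b) (suc i) = suc (punchIn b i)

punchOut-< : ∀ {b x k} → x ≢ b → b ℕ.< k → x ℕ.< k → punchOut b x ℕ.< ℕ.pred k
punchOut-< {zero}  {zero}  x≢b _               _         = ⊥-elim (x≢b refl)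
punchOut-< {zero}  {suc x} _   _               (s≤s x<k) = x<k
punchOut-< {suc b} {zero}  _   (s≤s (s≤s _))   _         = s≤s z≤n
punchOut-< {suc b} {suc x} x≢b (s≤s b<k@(s≤s _)) (s≤s x<k) =
  s≤s (punchOut-< (x≢b ∘ cong suc) b<k x<k)

punchOut-injective : ∀ {b x y} → x ≢ b → y ≢ b → punchOut b x ≡ punchOut b y → x ≡ y
punchOut-injective {zero}  {zero}  x≢b _   _  = ⊥-elim (x≢b refl)
punchOut-injective {zero}  {suc _} {zero}  _ y≢b _  = ⊥-elim (y≢b refl)
punchOut-injective {zero}  {suc _} {suc _} _ _   eq = cong suc eq
punchOut-injective {suc b} {zero}  {zero}  _ _   _  = refl
punchOut-injective {suc b} {suc _} {suc _} x≢b y≢b eq =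
  cong suc (punchOut-injective (x≢b ∘ cong suc) (y≢b ∘ cong suc) (ℕ.suc-injective eq))

punchIn≢ : ∀ b i → punchIn b i ≢ b
punchIn≢ (suc b) (suc i) eq = punchIn≢ b i (ℕ.suc-injective eq)

punchIn-< : ∀ b {i k} → i ℕ.< ℕ.pred k → punchIn b i ℕ.< k
punchIn-< zero    {k = suc k} i<k       = s≤s i<k
punchIn-< (suc b) {zero}  {suc k} _     = s≤s z≤n
punchIn-< (suc b) {suc i} {suc (suc k)} (s≤s i<k) = s≤s (punchIn-< b i<k)

punchOut-punchIn : ∀ b i → punchOut b (punchIn b i) ≡ i
punchOut-punchIn zero    i       = refl
punchOut-punchIn (suc b) zero    = refl
punchOut-punchIn (suc b) (suc i) = cong suc (punchOut-punchIn b i)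

redirect : ℕ → ℕ → ℕ → ℕ
redirect a b l with l ℕ.≟ b
... | yes _ = a
... | no  _ = l

redirect-≢ : ∀ {a b} l → a ≢ b → redirect a b l ≢ b
redirect-≢ {b = b} l a≢b with l ℕ.≟ b
... | yes _   = a≢b
... | no  l≢b = l≢b

redirect-< : ∀ {a b l k} → a ℕ.< k → l ℕ.< k → redirect a b l ℕ.< k
redirect-< {b = b} {l} a<k l<k with l ℕ.≟ b
... | yes _ = a<k
... | no  _ = l<k

redirect-id : ∀ {a b l} → l ≢ b → redirect a b l ≡ l
redirect-id {b = b} {l} l≢b with l ℕ.≟ b
... | yes l≡b = ⊥-elim (l≢b l≡b)
... | no  _   = refl

redirect-a≡redirect-b : ∀ a b → redirect a b a ≡ redirect a b b
redirect-a≡redirect-b a b with a ℕ.≟ b | b ℕ.≟ b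
... | _     | no b≢b = ⊥-elim (b≢b refl)
... | yes _ | yes _  = refl
... | no  _ | yes _  = refl

redirect-injective : ∀ {a b} l l′ → redirect a b l ≡ redirect a b l′ →
                     l ≡ l′ ⊎ (l ≡ a × l′ ≡ b) ⊎ (l′ ≡ a × l ≡ b)
redirect-injective {b = b} l l′ eq with l ℕ.≟ b | l′ ℕ.≟ b
... | yes l≡b | yes l′≡b = inj₁ (trans l≡b (sym l′≡b))
... | yes l≡b | no  _    = inj₂ (inj₂ (sym eq , l≡b))
... | no  _   | yes l′≡b = inj₂ (inj₁ (eq , l′≡b))
... | no  _   | no  _    = inj₁ eq

merge : ℕ → ℕ → ℕ → ℕ
merge a b = punchOut b ∘ redirect a b

merge-< : ∀ {a b l k} → a ≢ b → a ℕ.< k → b ℕ.< k → l ℕ.< k → merge a b l ℕ.< ℕ.pred k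
merge-< {l = l} a≢b a<k b<k l<k = punchOut-< (redirect-≢ l a≢b) b<k (redirect-< a<k l<k)

merge-surjective : ∀ a b {i k} → i ℕ.< ℕ.pred k → ∃ λ l → l ℕ.< k × merge a b l ≡ i
merge-surjective a b {i} i<k =
  punchIn b i , punchIn-< b i<k ,
  trans (cong (punchOut b) (redirect-id (punchIn≢ b i))) (punchOut-punchIn b i)

merge-identifies : ∀ a b → merge a b a ≡ merge a b b
merge-identifies a b = cong (punchOut b) (redirect-a≡redirect-b a b)

merge-injective : ∀ {a b} l l′ → a ≢ b → merge a b l ≡ merge a b l′ →
                  l ≡ l′ ⊎ (l ≡ a × l′ ≡ b) ⊎ (l′ ≡ a × l ≡ b)
merge-injective l l′ a≢b eq =
  redirect-injective l l′ (punchOut-injective (redirect-≢ l a≢b) (redirect-≢ l′ a≢b) eq)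

-- Putting v back joins it to the component of m and merges at most that of a with it.
module Restore (K : Graph) (S : Subset (nV K)) {v a m : Fin (nV K)}
  (v∈S : v ∈ S) (m∉S : m ∉ S) (v~a : Adj K v a) (v~m : Adj K v m)
  (N[v]⊆am : ∀ {w} → Adj K v w → w ≡ a ⊎ w ≡ m) {k} (nc : NumComponents K S k) where

  private
    f : Fin (nV K) → ℕ
    f = label nc

  ∉S⇒≢v : ∀ {w} → w ∉ S → w ≢ v
  ∉S⇒≢v w∉S refl = w∉S v∈S

  Conn-mono : ∀ {u w} → Conn K S u w → Conn K (S - v) u w
  Conn-mono = Conn-map (λ u∉ w∉ → Conn-edge (x∉p⇒x∉p-y u∉) (x∉p⇒x∉p-y w∉)) x∉p⇒x∉p-y

  a-v-m : a ∉ S → Conn K (S - v) a m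
  a-v-m a∉S = step (x∉p⇒x∉p-y a∉S) (x∉p-x S v) (Adj-sym v~a) (Conn-edge (x∉p-x S v) (x∉p⇒x∉p-y m∉S) v~m)

  f° : Fin (nV K) → ℕ
  f° w with w Fin.≟ v
  ... | yes _ = f m
  ... | no  _ = f w

  f°-v : f° v ≡ f m
  f°-v with v Fin.≟ v
  ... | yes _   = refl
  ... | no  v≢v = ⊥-elim (v≢v refl)

  f°-≢v : ∀ {w} → w ≢ v → f° w ≡ f w
  f°-≢v {w} w≢v with w Fin.≟ v
  ... | yes w≡v = ⊥-elim (w≢v w≡v)
  ... | no  _   = refl

  representative : ∀ {w} → w ∉ S - v → ∃ λ w* → w* ∉ S × f w* ≡ f° w × Conn K (S - v) w w*
  representative {w} w∉ with w Fin.≟ v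
  ... | yes refl = m , m∉S , refl , Conn-edge w∉ (x∉p⇒x∉p-y m∉S) v~m
  ... | no  w≢v  = w , x∉p-y⇒x∉p w≢v w∉ , refl , here w∉

  Linked : ℕ → ℕ → Set
  Linked l l′ = a ∉ S × l ≡ f a × l′ ≡ f m

  Linked⇒Conn : ∀ {u w} → u ∉ S → w ∉ S → Linked (f u) (f w) → Conn K (S - v) u w
  Linked⇒Conn u∉ w∉ (a∉S , fu≡fa , fw≡fm) =
    Conn-trans (Conn-mono (label≡⇒Conn nc u∉ a∉S fu≡fa))
      (Conn-trans (a-v-m a∉S) (Conn-mono (label≡⇒Conn nc m∉S w∉ (sym fw≡fm))))

  relabelledComponents :
    (h : ℕ → ℕ) (k′ : ℕ) →
    (∀ {l} → l ℕ.< k → h l ℕ.< k′) →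
    (∀ {i} → i ℕ.< k′ → ∃ λ l → l ℕ.< k × h l ≡ i) →
    (a ∉ S → h (f a) ≡ h (f m)) →
    (∀ l l′ → h l ≡ h l′ → l ≡ l′ ⊎ Linked l l′ ⊎ Linked l′ l) →
    NumComponents K (S - v) k′
  relabelledComponents h k′ h< h-surjective h-a≡h-m h-injective =
    numComponents k′ (h ∘ f°) g< g-surjective g-edge g≡⇒Conn
    where
    g< : ∀ {w} → w ∉ S - v → h (f° w) ℕ.< k′
    g< w∉ with representative w∉
    ... | w* , w*∉ , fw*≡ , _ = h< (subst (ℕ._< k) fw*≡ (label< nc w*∉))

    g-surjective : ∀ {i} → i ℕ.< k′ → ∃ λ w → w ∉ S - v × h (f° w) ≡ i
    g-surjective i<k′ with h-surjective i<k′
    ... | l , l<k , hl≡i with label-surjective nc l<k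
    ... | w , w∉S , fw≡l = w , x∉p⇒x∉p-y w∉S , trans (cong h (trans (f°-≢v (∉S⇒≢v w∉S)) fw≡l)) hl≡i

    g-v-edge : ∀ {w} → w ≢ v → w ∉ S - v → Adj K v w → h (f° v) ≡ h (f° w)
    g-v-edge w≢v w∉ v~w with N[v]⊆am v~w
    ... | inj₁ refl = trans (cong h f°-v) (trans (sym (h-a≡h-m a∉S)) (cong h (sym (f°-≢v w≢v))))
      where a∉S = x∉p-y⇒x∉p w≢v w∉
    ... | inj₂ refl = cong h (trans f°-v (sym (f°-≢v (∉S⇒≢v m∉S))))

    g-edge-cases : ∀ {u w} → Dec (u ≡ v) → Dec (w ≡ v) →
                   u ∉ S - v → w ∉ S - v → Adj K u w → h (f° u) ≡ h (f° w)
    g-edge-cases (yes refl) (yes refl) _   _   _   = refl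
    g-edge-cases (yes refl) (no w≢v)   _   w∉ u~w = g-v-edge w≢v w∉ u~w
    g-edge-cases (no u≢v)   (yes refl) u∉ _   u~w = sym (g-v-edge u≢v u∉ (Adj-sym u~w))
    g-edge-cases (no u≢v)   (no w≢v)   u∉ w∉ u~w = cong h (trans (f°-≢v u≢v) (trans fu≡fw (sym (f°-≢v w≢v))))
      where fu≡fw = Conn⇒label≡ nc (Conn-edge (x∉p-y⇒x∉p u≢v u∉) (x∉p-y⇒x∉p w≢v w∉) u~w)

    g-edge : ∀ {u w} → u ∉ S - v → w ∉ S - v → Adj K u w → h (f° u) ≡ h (f° w)
    g-edge {u} {w} = g-edge-cases (u Fin.≟ v) (w Fin.≟ v)

    g≡⇒Conn : ∀ {u w} → u ∉ S - v → w ∉ S - v → h (f° u) ≡ h (f° w) → Conn K (S - v) u w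
    g≡⇒Conn u∉ w∉ eq with representative u∉ | representative w∉
    ... | u* , u*∉ , fu*≡ , u~u* | w* , w*∉ , fw*≡ , w~w*
      with h-injective (f u*) (f w*) (subst₂ (λ x y → h x ≡ h y) (sym fu*≡) (sym fw*≡) eq)
    ... | inj₁ fu*≡fw*         = Conn-trans u~u* (Conn-trans (Conn-mono (label≡⇒Conn nc u*∉ w*∉ fu*≡fw*)) (Conn-sym w~w*))
    ... | inj₂ (inj₁ linked) = Conn-trans u~u* (Conn-trans (Linked⇒Conn u*∉ w*∉ linked) (Conn-sym w~w*))
    ... | inj₂ (inj₂ linked) = Conn-trans u~u* (Conn-trans (Conn-sym (Linked⇒Conn w*∉ u*∉ linked)) (Conn-sym w~w*))

  sameCount : (a ∉ S → f a ≡ f m) → NumComponents K (S - v) k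
  sameCount fa≡fm = relabelledComponents (λ l → l) k (λ l<k → l<k) (λ {i} i<k → i , i<k , refl) fa≡fm (λ _ _ → inj₁)

  components : ∃ λ k′ → NumComponents K (S - v) k′ × ℕ.pred k ℕ.≤ k′
  components with a ∈? S
  ... | yes a∈S = k , sameCount (λ a∉S → ⊥-elim (a∉S a∈S)) , ℕ.pred[n]≤n
  ... | no  a∉S with f a ℕ.≟ f m
  ... | yes fa≡fm = k , sameCount (λ _ → fa≡fm) , ℕ.pred[n]≤n
  ... | no  fa≢fm =
    ℕ.pred k ,
    relabelledComponents (merge (f a) (f m)) (ℕ.pred k)
      (merge-< fa≢fm (label< nc a∉S) (label< nc m∉S))
      (merge-surjective (f a) (f m))
      (λ _ → merge-identifies (f a) (f m))
      (λ l l′ eq → Data.Sum.map₂ (Data.Sum.map (a∉S ,_) (a∉S ,_)) (merge-injective l l′ fa≢fm eq)) ,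
    ℕ.≤-refl

-- If the edge lists E and E′ differ only at m, moving m into the cut set splits the component
-- of m in (n , E) − S into the isolated vertices z i and the component of ρ in
-- (n , E′) − (S ∪ ⁅ m ⁆).
module Split {n} {E E′ : List (ℕ × ℕ)} (S : Subset n) {m : Fin n} (m∉S : m ∉ S)
  {k} (nc : NumComponents (mkGraph n E) S k)
  (old⇒new : ∀ {u w} → Adj (mkGraph n E) u w → Adj (mkGraph n E′) u w)
  (new⇒old : ∀ {u w} → u ≢ m → w ≢ m → Adj (mkGraph n E′) u w → Adj (mkGraph n E) u w)
  {r} (z : Fin r → Fin n) (z-injective : ∀ {i j} → z i ≡ z j → i ≡ j)
  (z∉ : ∀ i → z i ∉ S ∪ ⁅ m ⁆) (z-label : ∀ i → label nc (z i) ≡ label nc m)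
  (z-isolated : ∀ i {w} → Adj (mkGraph n E′) (z i) w → w ∈ S ∪ ⁅ m ⁆)
  {ρ} (ρ∉ : ρ ∉ S ∪ ⁅ m ⁆) (ρ-label : label nc ρ ≡ label nc m) (ρ≢z : ∀ i → ρ ≢ z i)
  (cover : ∀ {u} → u ∉ S ∪ ⁅ m ⁆ → label nc u ≡ label nc m →
           (∃ λ i → u ≡ z i) ⊎ Conn (mkGraph n E′) (S ∪ ⁅ m ⁆) ρ u)
  where

  private
    Old New : Graph
    Old = mkGraph n E
    New = mkGraph n E′
    S° : Subset n
    S° = S ∪ ⁅ m ⁆
    f : Fin n → ℕ
    f = label nc
    L : ℕ
    L = f m

  Conn-new⇒old : ∀ {u w} → Conn New S° u w → Conn Old S u w
  Conn-new⇒old = Conn-map (λ u∉ w∉ u~w → Conn-edge (x∉p∪⁅y⁆⇒x∉p u∉) (x∉p∪⁅y⁆⇒x∉p w∉)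
                                           (new⇒old (x∉p∪⁅y⁆⇒x≢y u∉) (x∉p∪⁅y⁆⇒x≢y w∉) u~w))
                          x∉p∪⁅y⁆⇒x∉p

  -- z i gets the new label k + i; the rest of the component of m keeps its label L.
  g : Fin n → ℕ
  g u with f u ℕ.≟ L | Fin.any? (λ i → u Fin.≟ z i)
  ... | no  _ | _           = f u
  ... | yes _ | yes (i , _) = k + toℕ i
  ... | yes _ | no  _       = L

  g-other : ∀ {u} → f u ≢ L → g u ≡ f u
  g-other {u} fu≢L with f u ℕ.≟ L
  ... | yes fu≡L = ⊥-elim (fu≢L fu≡L)
  ... | no  _    = refl

  g-z : ∀ i → g (z i) ≡ k + toℕ i
  g-z i with f (z i) ℕ.≟ L | Fin.any? (λ j → z i Fin.≟ z j)
  ... | no  fz≢L | _               = ⊥-elim (fz≢L (z-label i))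
  ... | yes _    | yes (j , zi≡zj) = cong (λ j → k + toℕ j) (sym (z-injective zi≡zj))
  ... | yes _    | no  ∄j          = ⊥-elim (∄j (i , refl))

  g-rest : ∀ {u} → f u ≡ L → (∀ i → u ≢ z i) → g u ≡ L
  g-rest {u} fu≡L u≢z with f u ℕ.≟ L | Fin.any? (λ i → u Fin.≟ z i)
  ... | no  fu≢L | _              = ⊥-elim (fu≢L fu≡L)
  ... | yes _    | yes (i , u≡zi) = ⊥-elim (u≢z i u≡zi)
  ... | yes _    | no  _          = refl

  data Part (u : Fin n) : Set where
    other    : f u ≢ L → Part u
    isolated : ∀ i → u ≡ z i → Part u
    rest     : Conn New S° ρ u → Part u

  part : ∀ {u} → u ∉ S° → Part u
  part {u} u∉ with f u ℕ.≟ L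
  ... | no  fu≢L = other fu≢L
  ... | yes fu≡L with cover u∉ fu≡L
  ... | inj₁ (i , u≡zi) = isolated i u≡zi
  ... | inj₂ ρ~u        = rest ρ~u

  rest-label : ∀ {u} → Conn New S° ρ u → f u ≡ L
  rest-label ρ~u = trans (sym (Conn⇒label≡ nc (Conn-new⇒old ρ~u))) ρ-label

  rest-g : ∀ {u} → Conn New S° ρ u → g u ≡ L
  rest-g {u} ρ~u = g-rest (rest-label ρ~u) ρ≁z
    where
    ρ≁z : ∀ i → u ≢ z i
    ρ≁z i refl = ρ≢z i (sym (Conn-isolated (z-isolated i) (Conn-sym ρ~u)))

  g-cong : ∀ {u w} → Dec (f u ≡ L) → (∀ i → u ≢ z i) → (∀ i → w ≢ z i) → f u ≡ f w → g u ≡ g w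
  g-cong (yes fu≡L) u≢z w≢z fu≡fw = trans (g-rest fu≡L u≢z) (sym (g-rest (trans (sym fu≡fw) fu≡L) w≢z))
  g-cong (no  fu≢L) u≢z w≢z fu≡fw = trans (g-other fu≢L) (trans fu≡fw (sym (g-other (fu≢L ∘ trans fu≡fw))))

  neighbour≢z : ∀ {u w} → w ∉ S° → Adj New u w → ∀ i → u ≢ z i
  neighbour≢z w∉ u~w i refl = w∉ (z-isolated i u~w)

  g-edge : ∀ {u w} → u ∉ S° → w ∉ S° → Adj New u w → g u ≡ g w
  g-edge {u} u∉ w∉ u~w =
    g-cong (f u ℕ.≟ L) (neighbour≢z w∉ u~w) (neighbour≢z u∉ (Adj-sym u~w))
      (Conn⇒label≡ nc (Conn-edge (x∉p∪⁅y⁆⇒x∉p u∉) (x∉p∪⁅y⁆⇒x∉p w∉)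
                                 (new⇒old (x∉p∪⁅y⁆⇒x≢y u∉) (x∉p∪⁅y⁆⇒x≢y w∉) u~w)))

  Conn-avoid : ∀ {u w} → Conn Old S u w → f u ≢ L → Conn New S° u w
  Conn-avoid (here u∉) fu≢L = here (x∉p∧x≢y⇒x∉p∪⁅y⁆ u∉ λ { refl → fu≢L refl })
  Conn-avoid (step u∉ w∉ u~w c) fu≢L =
    step (x∉p∧x≢y⇒x∉p∪⁅y⁆ u∉ λ { refl → fu≢L refl }) (x∉p∧x≢y⇒x∉p∪⁅y⁆ w∉ λ { refl → fw≢L refl })
         (old⇒new u~w) (Conn-avoid c fw≢L)
    where fw≢L = fu≢L ∘ trans (Conn⇒label≡ nc (Conn-edge u∉ w∉ u~w))

  <k⇒≢k+ : ∀ {a} i → a ℕ.< k → a ≢ k + i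
  <k⇒≢k+ i a<k refl = ℕ.<⇒≱ a<k (ℕ.m≤m+n k i)

  g< : ∀ {u} → u ∉ S° → g u ℕ.< k + r
  g< u∉ with part u∉
  ... | other fu≢L    =
    subst (ℕ._< k + r) (sym (g-other fu≢L)) (ℕ.≤-trans (label< nc (x∉p∪⁅y⁆⇒x∉p u∉)) (ℕ.m≤m+n k r))
  ... | isolated i refl = subst (ℕ._< k + r) (sym (g-z i)) (ℕ.+-monoʳ-< k (Fin.toℕ<n i))
  ... | rest ρ~u       = subst (ℕ._< k + r) (sym (rest-g ρ~u)) (ℕ.≤-trans (label< nc m∉S) (ℕ.m≤m+n k r))

  g-surjective : ∀ {i} → i ℕ.< k + r → ∃ λ u → u ∉ S° × g u ≡ i
  g-surjective {i} i<k+r with i ℕ.<? k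
  ... | no i≮k = z j , z∉ j , trans (g-z j) (trans (cong (k +_) (Fin.toℕ-fromℕ< i∸k<r)) (ℕ.m+[n∸m]≡n k≤i))
    where
    k≤i = ℕ.≮⇒≥ i≮k
    i∸k<r : i ∸ k ℕ.< r
    i∸k<r = subst (i ∸ k ℕ.<_) (ℕ.m+n∸m≡n k r) (ℕ.∸-monoˡ-< i<k+r k≤i)
    j = Fin.fromℕ< i∸k<r
  ... | yes i<k with i ℕ.≟ L
  ... | yes refl = ρ , ρ∉ , rest-g (here ρ∉)
  ... | no  i≢L with label-surjective nc i<k
  ... | w , w∉S , fw≡i =
    w , x∉p∧x≢y⇒x∉p∪⁅y⁆ w∉S (λ { refl → i≢L (sym fw≡i) }) , trans (g-other (i≢L ∘ trans (sym fw≡i))) fw≡i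

  joined : ∀ {u w} → u ∉ S° → w ∉ S° → Part u → Part w → g u ≡ g w → Conn New S° u w
  joined u∉ w∉ (other fu≢L) (other fw≢L) eq =
    Conn-avoid (label≡⇒Conn nc (x∉p∪⁅y⁆⇒x∉p u∉) (x∉p∪⁅y⁆⇒x∉p w∉)
                 (trans (sym (g-other fu≢L)) (trans eq (g-other fw≢L))))
               fu≢L
  joined u∉ _ (other fu≢L) (isolated j refl) eq =
    ⊥-elim (<k⇒≢k+ (toℕ j) (label< nc (x∉p∪⁅y⁆⇒x∉p u∉)) (trans (sym (g-other fu≢L)) (trans eq (g-z j))))
  joined _ _ (other fu≢L) (rest ρ~w) eq = ⊥-elim (fu≢L (trans (sym (g-other fu≢L)) (trans eq (rest-g ρ~w))))
  joined _ w∉ (isolated i refl) (other fw≢L) eq =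
    ⊥-elim (<k⇒≢k+ (toℕ i) (label< nc (x∉p∪⁅y⁆⇒x∉p w∉)) (trans (sym (g-other fw≢L)) (trans (sym eq) (g-z i))))
  joined u∉ _ (isolated i refl) (isolated j refl) eq =
    subst (λ j → Conn New S° (z i) (z j))
          (Fin.toℕ-injective (ℕ.+-cancelˡ-≡ k _ _ (trans (sym (g-z i)) (trans eq (g-z j)))))
          (here u∉)
  joined _ _ (isolated i refl) (rest ρ~w) eq =
    ⊥-elim (<k⇒≢k+ (toℕ i) (label< nc m∉S) (trans (sym (rest-g ρ~w)) (trans (sym eq) (g-z i))))
  joined _ _ (rest ρ~u) (other fw≢L) eq = ⊥-elim (fw≢L (trans (sym (g-other fw≢L)) (trans (sym eq) (rest-g ρ~u))))
  joined _ _ (rest ρ~u) (isolated j refl) eq =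
    ⊥-elim (<k⇒≢k+ (toℕ j) (label< nc m∉S) (trans (sym (rest-g ρ~u)) (trans eq (g-z j))))
  joined _ _ (rest ρ~u) (rest ρ~w) _ = Conn-trans (Conn-sym ρ~u) ρ~w

  components : NumComponents New S° (k + r)
  components = numComponents (k + r) g g< g-surjective g-edge (λ u∉ w∉ → joined u∉ w∉ (part u∉) (part w∉))

excess-after-restore : ∀ {s′ s k k′} → s′ ℕ.< s → s + s ℕ.< k → ℕ.pred k ℕ.≤ k′ →
                       2 ℕ.≤ k′ × s′ + s′ ℕ.< k′
excess-after-restore {s′} {s} {k} {k′} s′<s s+s<k pred-k≤k′ =
  ℕ.≤-trans (ℕ.m≤m+n 2 (s′ + s′)) 2+s′+s′≤k′ , ℕ.≤-trans (ℕ.n≤1+n _) 2+s′+s′≤k′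
  where
  open ℕ.≤-Reasoning
  2+s′+s′≤k′ : 2 + (s′ + s′) ℕ.≤ k′
  2+s′+s′≤k′ = begin
    2 + (s′ + s′)   ≡⟨ cong suc (ℕ.+-suc s′ s′) ⟨
    suc s′ + suc s′ ≤⟨ ℕ.+-mono-≤ s′<s s′<s ⟩
    s + s           ≤⟨ ℕ.<⇒≤pred s+s<k ⟩
    ℕ.pred k        ≤⟨ pred-k≤k′ ⟩
    k′              ∎

excess-after-split : ∀ {s s° k r} → s° ℕ.≤ suc s → s + s ℕ.< k → 2 ℕ.≤ r → s° + s° ℕ.< k + r
excess-after-split {s} {s°} {k} {r} s°≤1+s s+s<k 2≤r = begin-strict
  s° + s°         ≤⟨ ℕ.+-mono-≤ s°≤1+s s°≤1+s ⟩
  suc s + suc s   ≡⟨ cong suc (ℕ.+-suc s s) ⟩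
  2 + (s + s)     <⟨ ℕ.+-monoʳ-< 2 s+s<k ⟩
  2 + k           ≤⟨ ℕ.+-monoˡ-≤ k 2≤r ⟩
  r + k           ≡⟨ ℕ.+-comm r k ⟩
  k + r           ∎
  where open ℕ.≤-Reasoning

-- R₃,₃ and the deletion of x₁m

-- R₃,₃ on Fin 9: 0 = s, 1–3 = x₁–x₃, 4 = m, 5–7 = y₁–y₃, 8 = t.
R₃₃-edge : ℕ → ℕ → Bool
R₃₃-edge 0 1 = true
R₃₃-edge 0 2 = true
R₃₃-edge 0 3 = true
R₃₃-edge 1 4 = true
R₃₃-edge 2 4 = true
R₃₃-edge 3 4 = true
R₃₃-edge 4 5 = true
R₃₃-edge 4 6 = true
R₃₃-edge 4 7 = true
R₃₃-edge 5 8 = true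
R₃₃-edge 6 8 = true
R₃₃-edge 7 8 = true
R₃₃-edge _ _ = false

infix 4 _~ᴿ_ _~ᴴ_

_~ᴿ_ : Fin 9 → Fin 9 → Bool
i ~ᴿ j = R₃₃-edge (toℕ i) (toℕ j) ∨ R₃₃-edge (toℕ j) (toℕ i)

_~ᴴ_ : Fin 9 → Fin 9 → Bool
i ~ᴴ j = (i ~ᴿ j) ∧ not (x₁m (toℕ i) (toℕ j))
  where
  x₁m : ℕ → ℕ → Bool
  x₁m 1 4 = true
  x₁m 4 1 = true
  x₁m _ _ = false

interior : Fin 9 → Bool
interior i = inner (toℕ i)
  where
  inner : ℕ → Bool
  inner 0 = false
  inner 8 = false
  inner _ = true

-- the interior vertices of degree two other than x₁, and the terminal each is attached to
spoke : Fin 9 → Bool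
spoke i = interior i ∧ not (hub (toℕ i))
  where
  hub : ℕ → Bool
  hub 1 = true
  hub 4 = true
  hub _ = false

far : Fin 9 → Fin 9
far i = if toℕ i ℕ.<ᵇ 4 then # 0 else # 8

spoke-neighbours : ∀ i j → T (spoke i) → T (i ~ᴿ j) → j ≡ far i ⊎ j ≡ # 4
spoke-neighbours = from-yes (Fin.all? λ i → Fin.all? λ j →
  T? (spoke i) →-dec T? (i ~ᴿ j) →-dec (j Fin.≟ far i ⊎-dec j Fin.≟ # 4))

spoke-~ᴴ-far : ∀ i → T (spoke i) → T (i ~ᴴ far i)
spoke-~ᴴ-far = from-yes (Fin.all? λ i → T? (spoke i) →-dec T? (i ~ᴴ far i))

spoke-~ᴴ-m : ∀ i → T (spoke i) → T (i ~ᴴ # 4)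
spoke-~ᴴ-m = from-yes (Fin.all? λ i → T? (spoke i) →-dec T? (i ~ᴴ # 4))

spoke-interior : ∀ i → T (spoke i) → T (interior i)
spoke-interior = from-yes (Fin.all? λ i → T? (spoke i) →-dec T? (interior i))

spoke≢m : ∀ i → T (spoke i) → i ≢ # 4
spoke≢m i spoke-i refl = spoke-i

m-neighbours : ∀ j → T (# 4 ~ᴿ j) → j ≡ # 1 ⊎ T (spoke j)
m-neighbours = from-yes (Fin.all? λ j → T? (# 4 ~ᴿ j) →-dec (j Fin.≟ # 1 ⊎-dec T? (spoke j)))

has-neighbour : ∀ i → ∃ λ j → T (i ~ᴿ j)
has-neighbour = from-yes (Fin.all? λ i → Fin.any? λ j → T? (i ~ᴿ j))

record R₃₃Copy (G : Graph) : Set where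
  field
    π               : Fin 9 → Fin (nV G)
    π-injective     : ∀ {i j} → π i ≡ π j → i ≡ j
    π-adj           : ∀ i j → T (i ~ᴿ j) → Adj G (π i) (π j)
    interior-closed : ∀ i → T (interior i) → ∀ {w} → Adj G (π i) w → ∃ λ j → T (i ~ᴿ j) × w ≡ π j

module WithoutX₁M (G : Graph) (C : R₃₃Copy G) where
  open R₃₃Copy C

  V : Set
  V = Fin (nV G)

  s x₁ m t : V
  s  = π (# 0)
  x₁ = π (# 1)
  m  = π (# 4)
  t  = π (# 8)

  IsX₁M : V → V → Set
  IsX₁M u w = (u ≡ x₁ × w ≡ m) ⊎ (u ≡ m × w ≡ x₁)

  x₁m-index : Σ (Fin (length (edges G))) λ e →
              lookup (edges G) e ≡ (toℕ x₁ , toℕ m) ⊎ lookup (edges G) e ≡ (toℕ m , toℕ x₁)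
  x₁m-index with π-adj (# 1) (# 4) tt
  ... | inj₁ x₁m∈ = Any.index x₁m∈ , inj₁ (sym (lookup-index x₁m∈))
  ... | inj₂ mx₁∈ = Any.index mx₁∈ , inj₂ (sym (lookup-index mx₁∈))

  e : Fin (length (edges G))
  e = proj₁ x₁m-index

  H : Graph
  H = deleteEdge G e

  adjH⇒G : ∀ {u w} → Adj H u w → Adj G u w
  adjH⇒G = Data.Sum.map (removeAt-⊆ (edges G) e) (removeAt-⊆ (edges G) e)

  adjG⇒H : ∀ {u w} → Adj G u w → Adj H u w ⊎ IsX₁M u w
  adjG⇒H {u} {w} (inj₁ uw∈) with ∈-removeAt⁻ (edges G) e uw∈
  ... | inj₁ uw∈H = inj₁ (inj₁ uw∈H)
  ... | inj₂ uw≡e = inj₂ (Data.Sum.map toℕ-pair-injective toℕ-pair-injective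
                            (Data.Sum.map (trans uw≡e) (trans uw≡e) (proj₂ x₁m-index)))
    where
    toℕ-pair-injective : ∀ {u w u′ w′ : V} → (toℕ u , toℕ w) ≡ (toℕ u′ , toℕ w′) → u ≡ u′ × w ≡ w′
    toℕ-pair-injective eq = Fin.toℕ-injective (,-injectiveˡ eq) , Fin.toℕ-injective (,-injectiveʳ eq)
  adjG⇒H (inj₂ wu∈) with adjG⇒H (inj₁ wu∈)
  ... | inj₁ w~u              = inj₁ (Adj-sym w~u)
  ... | inj₂ (inj₁ (p , q)) = inj₂ (inj₂ (q , p))
  ... | inj₂ (inj₂ (p , q)) = inj₂ (inj₁ (q , p))

  π-adjH : ∀ i j → T (i ~ᴴ j) → Adj H (π i) (π j)
  π-adjH i j i~ᴴj with adjG⇒H (π-adj i j (proj₁ (Equivalence.to T-∧ i~ᴴj)))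
  ... | inj₁ πi~πj = πi~πj
  ... | inj₂ (inj₁ (p , q)) with π-injective p | π-injective q
  ...   | refl | refl = ⊥-elim i~ᴴj
  π-adjH i j i~ᴴj | inj₂ (inj₂ (p , q)) with π-injective p | π-injective q
  ...   | refl | refl = ⊥-elim i~ᴴj

  adjG⇒H-off-m : ∀ {u w} → u ≢ m → w ≢ m → Adj G u w → Adj H u w
  adjG⇒H-off-m u≢m w≢m u~w with adjG⇒H u~w
  ... | inj₁ u~ᴴw              = u~ᴴw
  ... | inj₂ (inj₁ (_ , w≡m)) = ⊥-elim (w≢m w≡m)
  ... | inj₂ (inj₂ (u≡m , _)) = ⊥-elim (u≢m u≡m)

  spoke-neighbours-in-G : ∀ i → T (spoke i) → ∀ {w} → Adj G (π i) w → w ≡ π (far i) ⊎ w ≡ m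
  spoke-neighbours-in-G i spoke-i πi~w with interior-closed i (spoke-interior i spoke-i) πi~w
  ... | j , i~j , refl = Data.Sum.map (cong π) (cong π) (spoke-neighbours i j spoke-i i~j)

  sameComponents : ∀ {S k} → (x₁ ∉ S → m ∉ S → Conn H S x₁ m) → NumComponents H S k → NumComponents G S k
  sameComponents {S} x₁~m (f , f< , f-surjective , f≡⇔Conn) =
    f , f< , f-surjective , λ u v u∉ v∉ → ⇔.trans (f≡⇔Conn u v u∉ v∉) (mk⇔ H⇒G G⇒H)
    where
    H⇒G : ∀ {u v} → Conn H S u v → Conn G S u v
    H⇒G = Conn-map (λ u∉ w∉ u~w → Conn-edge u∉ w∉ (adjH⇒G u~w)) id
    G-edge⇒H : ∀ {u w} → u ∉ S → w ∉ S → Adj G u w → Conn H S u w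
    G-edge⇒H u∉ w∉ u~w with adjG⇒H u~w
    ... | inj₁ u~ᴴw                 = Conn-edge u∉ w∉ u~ᴴw
    ... | inj₂ (inj₁ (refl , refl)) = x₁~m u∉ w∉
    ... | inj₂ (inj₂ (refl , refl)) = Conn-sym (x₁~m w∉ u∉)
    G⇒H : ∀ {u v} → Conn G S u v → Conn H S u v
    G⇒H = Conn-map G-edge⇒H id

  Excess : Subset (nV G) → ℕ → Set
  Excess S k = 2 ℕ.≤ k × ∣ S ∣ + ∣ S ∣ ℕ.< k

  module _ (G-tough : HalfTough G) where

    no-excess-in-G : ∀ {S k} → NumComponents G S k → ¬ Excess S k
    no-excess-in-G nc (2≤k , S+S<k) = ℕ.<⇒≱ S+S<k (G-tough _ _ nc 2≤k)

    module MinimalExcess (S : Subset (nV G))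
      (smaller-fine : ∀ S′ → ∣ S′ ∣ ℕ.< ∣ S ∣ → ∀ {k} → NumComponents H S′ k → ¬ Excess S′ k)
      {k} (nc : NumComponents H S k) (excess : Excess S k) where

      f : V → ℕ
      f = label nc

      x₁m-joined-impossible : (x₁ ∉ S → m ∉ S → Conn H S x₁ m) → ⊥
      x₁m-joined-impossible x₁~m = no-excess-in-G (sameComponents x₁~m nc) excess

      spoke∈S-impossible : m ∉ S → ∀ i → T (spoke i) → π i ∈ S → ⊥
      spoke∈S-impossible m∉S i spoke-i πi∈S
        with Restore.components H S πi∈S m∉S (π-adjH i (far i) (spoke-~ᴴ-far i spoke-i))
               (π-adjH i (# 4) (spoke-~ᴴ-m i spoke-i)) (spoke-neighbours-in-G i spoke-i ∘ adjH⇒G) nc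
      ... | k′ , nc′ , pred-k≤k′ =
        smaller-fine (S - π i) S-πi<S nc′ (excess-after-restore S-πi<S (proj₂ excess) pred-k≤k′)
        where
        S-πi<S : ∣ S - π i ∣ ℕ.< ∣ S ∣
        S-πi<S = x∈p⇒∣p-x∣<∣p∣ πi∈S

      module AllSpokesOutside (s∈S : s ∈ S) (x₁∉S : x₁ ∉ S) (m∉S : m ∉ S) (fx₁≢fm : f x₁ ≢ f m)
                              (∄spoke∈S : ¬ ∃ λ i → T (spoke i) × π i ∈ S) where

        spokes∉S : ∀ i → T (spoke i) → π i ∉ S
        spokes∉S i spoke-i πi∈S = ∄spoke∈S (i , spoke-i , πi∈S)

        S° : Subset (nV G)
        S° = S ∪ ⁅ m ⁆

        spoke∉S° : ∀ j → T (spoke j) → π j ∉ S°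
        spoke∉S° j spoke-j = x∉p∧x≢y⇒x∉p∪⁅y⁆ (spokes∉S j spoke-j) (spoke≢m j spoke-j ∘ π-injective)

        spoke-label : ∀ j → T (spoke j) → f (π j) ≡ f m
        spoke-label j spoke-j =
          Conn⇒label≡ nc (Conn-edge (spokes∉S j spoke-j) m∉S (π-adjH j (# 4) (spoke-~ᴴ-m j spoke-j)))

        -- a vertex of the component of m in H − S other than m is reached in G − S° from a spoke
        InComponent : V → Set
        InComponent u = u ≡ m ⊎ ∃ λ j → T (spoke j) × Conn G S° (π j) u

        inComponent-step : ∀ {u u′} → u ∉ S → u′ ∉ S → Adj H u u′ → InComponent u → InComponent u′
        inComponent-step u∉ u′∉ m~u′ (inj₁ refl) with interior-closed (# 4) tt (adjH⇒G m~u′)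
        ... | j , 4~j , refl with m-neighbours j 4~j
        ... | inj₁ refl    = ⊥-elim (fx₁≢fm (sym (Conn⇒label≡ nc (Conn-edge u∉ u′∉ m~u′))))  -- a parallel edge x₁m
        ... | inj₂ spoke-j = inj₂ (j , spoke-j , here (spoke∉S° j spoke-j))
        inComponent-step {u′ = u′} _ u′∉ u~u′ (inj₂ (j , spoke-j , πj~u)) with u′ Fin.≟ m
        ... | yes u′≡m = inj₁ u′≡m
        ... | no  u′≢m = inj₂ (j , spoke-j ,
          Conn-trans πj~u (Conn-edge (Conn-tgt πj~u) (x∉p∧x≢y⇒x∉p∪⁅y⁆ u′∉ u′≢m) (adjH⇒G u~u′)))

        inComponent-walk : ∀ {u w} → Conn H S u w → InComponent u → InComponent w
        inComponent-walk (here _)             inC = inC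
        inComponent-walk (step u∉ w∉ u~w c) inC = inComponent-walk c (inComponent-step u∉ w∉ u~w inC)

        inComponent : ∀ {u} → u ∉ S → f u ≡ f m → InComponent u
        inComponent u∉ fu≡fm = inComponent-walk (label≡⇒Conn nc m∉S u∉ (sym fu≡fm)) (inj₁ refl)

        -- Moving m into the cut set isolates the spokes zᵢ, whose far end lies in S.
        isolate-spokes : ∀ {r} (zi : Fin r → Fin 9) → 2 ℕ.≤ r → (∀ {i j} → zi i ≡ zi j → i ≡ j) →
                         (∀ i → T (spoke (zi i))) → (∀ i → π (far (zi i)) ∈ S) →
                         ∀ ρi → (∀ i → ρi ≢ zi i) → π ρi ∉ S° → f (π ρi) ≡ f m →
                         (∀ j → T (spoke j) → (∃ λ i → j ≡ zi i) ⊎ Conn G S° (π ρi) (π j)) → ⊥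
        isolate-spokes {r} zi 2≤r zi-injective zi-spoke zi-far∈S ρi ρi≢zi ρ∉ ρ-label covered =
          no-excess-in-G (Split.components S m∉S nc adjH⇒G adjG⇒H-off-m (π ∘ zi) (zi-injective ∘ π-injective)
                            (λ i → spoke∉S° (zi i) (zi-spoke i)) (λ i → spoke-label (zi i) (zi-spoke i))
                            z-isolated ρ∉ ρ-label (λ i → ρi≢zi i ∘ π-injective) cover)
            (ℕ.≤-trans 2≤r (ℕ.m≤n+m r k) , excess-after-split (∣p∪⁅x⁆∣≤1+∣p∣ S m) (proj₂ excess) 2≤r)
          where
          z-isolated : ∀ i {w} → Adj G (π (zi i)) w → w ∈ S°
          z-isolated i zi~w with spoke-neighbours-in-G (zi i) (zi-spoke i) zi~w
          ... | inj₁ refl = x∈p∪q⁺ (inj₁ (zi-far∈S i))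
          ... | inj₂ refl = x∈p∪q⁺ (inj₂ (x∈⁅x⁆ m))
          cover : ∀ {u} → u ∉ S° → f u ≡ f m → (∃ λ i → u ≡ π (zi i)) ⊎ Conn G S° (π ρi) u
          cover u∉ fu≡fm with inComponent (x∉p∪⁅y⁆⇒x∉p u∉) fu≡fm
          ... | inj₁ u≡m = ⊥-elim (x∉p∪⁅y⁆⇒x≢y u∉ u≡m)
          ... | inj₂ (j , spoke-j , πj~u) with covered j spoke-j
          ... | inj₁ (i , refl) = inj₁ (i , sym (Conn-isolated (z-isolated i) πj~u))
          ... | inj₂ ρ~πj       = inj₂ (Conn-trans ρ~πj πj~u)

        t∉S-impossible : t ∉ S → ⊥
        t∉S-impossible t∉S = isolate-spokes zi (s≤s (s≤s z≤n)) (λ {i} {j} → zi-injective i j) zi-spoke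
                               (λ { 0F → s∈S ; 1F → s∈S })
                    (# 8) 8≢zi t∉S° t-label covered
          where
          zi : Fin 2 → Fin 9
          zi 0F = # 2
          zi 1F = # 3
          zi-injective : ∀ i j → zi i ≡ zi j → i ≡ j
          zi-injective = from-yes (Fin.all? λ i → Fin.all? λ j → (zi i Fin.≟ zi j) →-dec (i Fin.≟ j))
          zi-spoke : ∀ i → T (spoke (zi i))
          zi-spoke = from-yes (Fin.all? λ i → T? (spoke (zi i)))
          8≢zi : ∀ i → # 8 ≢ zi i
          8≢zi = from-yes (Fin.all? λ i → ¬? (# 8 Fin.≟ zi i))
          t∉S° : t ∉ S°
          t∉S° = x∉p∧x≢y⇒x∉p∪⁅y⁆ t∉S (λ t≡m → case π-injective t≡m of λ ())
          t-label : f t ≡ f m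
          t-label = trans (Conn⇒label≡ nc (Conn-edge t∉S (spokes∉S (# 5) tt) (π-adjH (# 8) (# 5) tt))) (spoke-label (# 5) tt)
          spoke-zi-or-y : ∀ j → T (spoke j) → (∃ λ i → j ≡ zi i) ⊎ T (# 8 ~ᴿ j)
          spoke-zi-or-y = from-yes (Fin.all? λ j → T? (spoke j) →-dec (Fin.any? (λ i → j Fin.≟ zi i) ⊎-dec T? (# 8 ~ᴿ j)))
          covered : ∀ j → T (spoke j) → (∃ λ i → j ≡ zi i) ⊎ Conn G S° t (π j)
          covered j spoke-j = Data.Sum.map₂ (Conn-edge t∉S° (spoke∉S° j spoke-j) ∘ π-adj (# 8) j) (spoke-zi-or-y j spoke-j)

        t∈S-impossible : t ∈ S → ⊥
        t∈S-impossible t∈S = isolate-spokes zi (s≤s (s≤s z≤n)) (λ {i} {j} → zi-injective i j) zi-spoke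
                    (λ { 0F → s∈S ; 1F → s∈S ; 2F → t∈S ; 3F → t∈S })
                    (# 5) 5≢zi (spoke∉S° (# 5) tt) (spoke-label (# 5) tt) covered
          where
          zi : Fin 4 → Fin 9
          zi 0F = # 2
          zi 1F = # 3
          zi 2F = # 6
          zi 3F = # 7
          zi-injective : ∀ i j → zi i ≡ zi j → i ≡ j
          zi-injective = from-yes (Fin.all? λ i → Fin.all? λ j → (zi i Fin.≟ zi j) →-dec (i Fin.≟ j))
          zi-spoke : ∀ i → T (spoke (zi i))
          zi-spoke = from-yes (Fin.all? λ i → T? (spoke (zi i)))
          5≢zi : ∀ i → # 5 ≢ zi i
          5≢zi = from-yes (Fin.all? λ i → ¬? (# 5 Fin.≟ zi i))
          spoke-zi-or-y₁ : ∀ j → T (spoke j) → (∃ λ i → j ≡ zi i) ⊎ j ≡ # 5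
          spoke-zi-or-y₁ = from-yes (Fin.all? λ j → T? (spoke j) →-dec (Fin.any? (λ i → j Fin.≟ zi i) ⊎-dec j Fin.≟ # 5))
          covered : ∀ j → T (spoke j) → (∃ λ i → j ≡ zi i) ⊎ Conn G S° (π (# 5)) (π j)
          covered j spoke-j = Data.Sum.map₂ (λ { refl → here (spoke∉S° (# 5) tt) }) (spoke-zi-or-y₁ j spoke-j)

      impossible : ⊥
      impossible with x₁ ∈? S | m ∈? S
      ... | yes x₁∈S | _        = x₁m-joined-impossible (λ x₁∉S _ → ⊥-elim (x₁∉S x₁∈S))
      ... | no _     | yes m∈S  = x₁m-joined-impossible (λ _ m∉S → ⊥-elim (m∉S m∈S))
      ... | no x₁∉S  | no m∉S with f x₁ ℕ.≟ f m
      ... | yes fx₁≡fm = x₁m-joined-impossible (λ _ _ → label≡⇒Conn nc x₁∉S m∉S fx₁≡fm)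
      ... | no  fx₁≢fm with Fin.any? (λ i → T? (spoke i) ×-dec (π i ∈? S))
      ... | yes (i , spoke-i , πi∈S) = spoke∈S-impossible m∉S i spoke-i πi∈S
      ... | no  ∄spoke∈S with s ∈? S
      ... | no s∉S = fx₁≢fm (Conn⇒label≡ nc x₁-s-x₂-m)
        where
        x₂∉S : π (# 2) ∉ S
        x₂∉S x₂∈S = ∄spoke∈S (# 2 , tt , x₂∈S)
        x₁-s-x₂-m : Conn H S x₁ m
        x₁-s-x₂-m = Conn-trans (Conn-edge x₁∉S s∉S (π-adjH (# 1) (# 0) tt))
                      (Conn-trans (Conn-edge s∉S x₂∉S (π-adjH (# 0) (# 2) tt))
                                  (Conn-edge x₂∉S m∉S (π-adjH (# 2) (# 4) tt)))
      ... | yes s∈S with t ∈? S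
      ... | yes t∈S = AllSpokesOutside.t∈S-impossible s∈S x₁∉S m∉S fx₁≢fm ∄spoke∈S t∈S
      ... | no  t∉S = AllSpokesOutside.t∉S-impossible s∈S x₁∉S m∉S fx₁≢fm ∄spoke∈S t∉S

    no-excess-in-H : ∀ S {k} → NumComponents H S k → ¬ Excess S k
    no-excess-in-H = WF.All.wfRec (On.wellFounded ∣_∣ <-wellFounded) _ _
      (λ S smaller-fine {k} nc excess → MinimalExcess.impossible S (λ _ → smaller-fine) nc excess)

    halfTough-H : HalfTough H
    halfTough-H S k nc 2≤k = ℕ.≮⇒≥ (λ S+S<k → no-excess-in-H S nc (2≤k , S+S<k))

R₃₃Copy⇒¬minimally-½-tough : ∀ G → R₃₃Copy G → ¬ MinimallyTough G ½
R₃₃Copy⇒¬minimally-½-tough G C ((G-½-tough , _) , minimal) with minimal (WithoutX₁M.e G C)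
... | t′ , t′<½ , (_ , no-tougher) =
  no-tougher ½ t′<½ (Equivalence.from (isTough½⇔halfTough _)
    (WithoutX₁M.halfTough-H G C (Equivalence.to (isTough½⇔halfTough G) G-½-tough)))

-- Copies of R₃,₃ in graphs of sp-trees

Bounded : ℕ × List (ℕ × ℕ) → Set
Bounded (n , E) = 2 ℕ.≤ n × All (λ (a , b) → a ℕ.< n × b ℕ.< n) E

serMapA≤ : ∀ {a n} → a ℕ.< n → serMapA a ℕ.≤ n
serMapA≤ {0}           _   = z≤n
serMapA≤ {1}           1<n = 1<n
serMapA≤ {suc (suc a)} a<n = a<n

module _ {nA nB : ℕ} (2≤nA : 2 ℕ.≤ nA) (2≤nB : 2 ℕ.≤ nB) where

  nA<nA+nB∸1 : nA ℕ.< nA + nB ∸ 1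
  nA<nA+nB∸1 = subst (nA ℕ.<_) (sym (ℕ.+-∸-assoc nA (ℕ.≤-trans (s≤s z≤n) 2≤nB)))
                     (ℕ.m<m+n nA (ℕ.∸-monoˡ-≤ 1 2≤nB))

  nA≤nA+nB∸2 : nA ℕ.≤ nA + nB ∸ 2
  nA≤nA+nB∸2 = subst (nA ℕ.≤_) (sym (ℕ.+-∸-assoc nA 2≤nB)) (ℕ.m≤m+n nA (nB ∸ 2))

  serMapA-< : ∀ {a} → a ℕ.< nA → serMapA a ℕ.< nA + nB ∸ 1
  serMapA-< a<nA = ℕ.≤-<-trans (serMapA≤ a<nA) nA<nA+nB∸1

  serMapB-< : ∀ {b} → b ℕ.< nB → serMapB nA b ℕ.< nA + nB ∸ 1
  serMapB-< {0}             _    = ℕ.≤-<-trans 2≤nA nA<nA+nB∸1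
  serMapB-< {1}             _    = ℕ.≤-<-trans (ℕ.≤-trans (s≤s z≤n) 2≤nA) nA<nA+nB∸1
  serMapB-< {suc (suc b)} b<nB =
    subst (λ x → suc (suc b) + nA ∸ 1 ℕ.< x ∸ 1) (ℕ.+-comm nB nA)
          (ℕ.∸-monoˡ-< (ℕ.+-monoˡ-< nA b<nB) (s≤s z≤n))

  parMapB-< : ∀ {b} → b ℕ.< nB → parMapB nA b ℕ.< nA + nB ∸ 2
  parMapB-< {0}             _    = ℕ.<-≤-trans (ℕ.≤-trans (s≤s z≤n) 2≤nA) nA≤nA+nB∸2
  parMapB-< {1}             _    = ℕ.<-≤-trans 2≤nA nA≤nA+nB∸2
  parMapB-< {suc (suc b)} b<nB =
    subst (λ x → suc (suc b) + nA ∸ 2 ℕ.< x ∸ 2) (ℕ.+-comm nB nA)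
          (ℕ.∸-monoˡ-< (ℕ.+-monoˡ-< nA b<nB) (s≤s (s≤s z≤n)))

bounded-ser2 : ∀ {A B} → Bounded A → Bounded B → Bounded (ser2 A B)
bounded-ser2 (2≤nA , EA<) (2≤nB , EB<) =
  ℕ.≤-trans 2≤nA (ℕ.<⇒≤ (nA<nA+nB∸1 2≤nA 2≤nB)) ,
  All.++⁺ (All.map⁺ (All.map (Data.Product.map (serMapA-< 2≤nA 2≤nB) (serMapA-< 2≤nA 2≤nB)) EA<))
          (All.map⁺ (All.map (Data.Product.map (serMapB-< 2≤nA 2≤nB) (serMapB-< 2≤nA 2≤nB)) EB<))

bounded-par2 : ∀ {A B} → Bounded A → Bounded B → Bounded (par2 A B)
bounded-par2 (2≤nA , EA<) (2≤nB , EB<) =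
  ℕ.≤-trans 2≤nA (nA≤nA+nB∸2 2≤nA 2≤nB) ,
  All.++⁺ (All.map (Data.Product.map (λ a< → ℕ.<-≤-trans a< (nA≤nA+nB∸2 2≤nA 2≤nB))
                                     (λ b< → ℕ.<-≤-trans b< (nA≤nA+nB∸2 2≤nA 2≤nB))) EA<)
          (All.map⁺ (All.map (Data.Product.map (parMapB-< 2≤nA 2≤nB) (parMapB-< 2≤nA 2≤nB)) EB<))

mutual
  build-bounded : ∀ T → Bounded (build T)
  build-bounded edge     = s≤s (s≤s z≤n) , (s≤s z≤n , s≤s (s≤s z≤n)) ∷ []
  build-bounded (ser xs) = buildSer-bounded xs
  build-bounded (par xs) = buildPar-bounded xs

  buildSer-bounded : ∀ xs → Bounded (buildSer xs)
  buildSer-bounded []                 = build-bounded edge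
  buildSer-bounded (x ∷ [])           = build-bounded x
  buildSer-bounded (x ∷ xs@(_ ∷ _)) = bounded-ser2 (build-bounded x) (buildSer-bounded xs)

  buildPar-bounded : ∀ xs → Bounded (buildPar xs)
  buildPar-bounded []                 = build-bounded edge
  buildPar-bounded (x ∷ [])           = build-bounded x
  buildPar-bounded (x ∷ xs@(_ ∷ _)) = bounded-par2 (build-bounded x) (buildPar-bounded xs)

serMapA-injective : ∀ {a b} → serMapA a ≡ serMapA b → a ≡ b
serMapA-injective {a} {b} eq = trans (sym (left-inverse a)) (trans (cong unSerMapA eq) (left-inverse b))
  where
  unSerMapA : ℕ → ℕ
  unSerMapA 2                   = 1
  unSerMapA (suc (suc (suc v))) = suc (suc v)
  unSerMapA _                   = 0
  left-inverse : ∀ a → unSerMapA (serMapA a) ≡ a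
  left-inverse 0             = refl
  left-inverse 1             = refl
  left-inverse (suc (suc a)) = refl

serMapA-interior : ∀ {v} → 2 ℕ.≤ v → 3 ℕ.≤ serMapA v
serMapA-interior (s≤s (s≤s _)) = s≤s (s≤s (s≤s z≤n))

module _ {nA : ℕ} (2≤nA : 2 ℕ.≤ nA) where

  serMapB-interior : ∀ {v} → 2 ℕ.≤ v → suc nA ℕ.≤ serMapB nA v
  serMapB-interior {suc (suc v)} (s≤s (s≤s _)) = s≤s (ℕ.m≤n+m nA v)

  parMapB-interior : ∀ {v} → 2 ℕ.≤ v → nA ℕ.≤ parMapB nA v
  parMapB-interior {suc (suc v)} (s≤s (s≤s _)) = ℕ.m≤n+m nA v

  ≤2⇒≢serMapB-interior : ∀ {x v} → x ℕ.≤ 2 → 2 ℕ.≤ v → x ≢ serMapB nA v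
  ≤2⇒≢serMapB-interior x≤2 2≤v = ℕ.<⇒≢ (ℕ.≤-<-trans x≤2 (ℕ.≤-trans (s≤s 2≤nA) (serMapB-interior 2≤v)))

  <2⇒≢parMapB-interior : ∀ {x v} → x ℕ.< 2 → 2 ℕ.≤ v → x ≢ parMapB nA v
  <2⇒≢parMapB-interior x<2 2≤v = ℕ.<⇒≢ (ℕ.<-≤-trans x<2 (ℕ.≤-trans 2≤nA (parMapB-interior 2≤v)))

  serMapB-injective : ∀ {a b} → serMapB nA a ≡ serMapB nA b → a ≡ b
  serMapB-injective {0}           {0}           _  = refl
  serMapB-injective {1}           {1}           _  = refl
  serMapB-injective {suc (suc a)} {suc (suc b)} eq =
    cong (suc ∘ suc) (ℕ.+-cancelʳ-≡ nA a b (ℕ.suc-injective eq))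
  serMapB-injective {0}           {suc (suc b)} eq = ⊥-elim (≤2⇒≢serMapB-interior ℕ.≤-refl (s≤s (s≤s z≤n)) eq)
  serMapB-injective {1}           {suc (suc b)} eq = ⊥-elim (≤2⇒≢serMapB-interior (s≤s z≤n) (s≤s (s≤s z≤n)) eq)
  serMapB-injective {suc (suc a)} {0}           eq = ⊥-elim (≤2⇒≢serMapB-interior ℕ.≤-refl (s≤s (s≤s z≤n)) (sym eq))
  serMapB-injective {suc (suc a)} {1}           eq = ⊥-elim (≤2⇒≢serMapB-interior (s≤s z≤n) (s≤s (s≤s z≤n)) (sym eq))

  parMapB-injective : ∀ {a b} → parMapB nA a ≡ parMapB nA b → a ≡ b
  parMapB-injective {0}           {0}           _  = refl
  parMapB-injective {1}           {1}           _  = refl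
  parMapB-injective {suc (suc a)} {suc (suc b)} eq = cong (suc ∘ suc) (ℕ.+-cancelʳ-≡ nA a b eq)
  parMapB-injective {0}           {suc (suc b)} eq = ⊥-elim (<2⇒≢parMapB-interior (s≤s z≤n) (s≤s (s≤s z≤n)) eq)
  parMapB-injective {1}           {suc (suc b)} eq = ⊥-elim (<2⇒≢parMapB-interior ℕ.≤-refl (s≤s (s≤s z≤n)) eq)
  parMapB-injective {suc (suc a)} {0}           eq = ⊥-elim (<2⇒≢parMapB-interior (s≤s z≤n) (s≤s (s≤s z≤n)) (sym eq))
  parMapB-injective {suc (suc a)} {1}           eq = ⊥-elim (<2⇒≢parMapB-interior ℕ.≤-refl (s≤s (s≤s z≤n)) (sym eq))

Respects : (Fin 9 → ℕ) → ℕ × ℕ → Set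
Respects π (a , b) = ∀ i → T (interior i) →
  (a ≡ π i → ∃ λ j → T (i ~ᴿ j) × b ≡ π j) × (b ≡ π i → ∃ λ j → T (i ~ᴿ j) × a ≡ π j)

Avoids : (Fin 9 → ℕ) → ℕ × ℕ → Set
Avoids π (a , b) = ∀ i → T (interior i) → a ≢ π i × b ≢ π i

avoids⇒respects : ∀ {π} p → Avoids π p → Respects π p
avoids⇒respects _ avoids i interior-i = ⊥-elim ∘ proj₁ (avoids i interior-i) , ⊥-elim ∘ proj₂ (avoids i interior-i)

-- R₃₃Copy on the vertex labels of an edge list, the form in which it survives series and
-- parallel joins
record R₃₃Copyᴺ (E : List (ℕ × ℕ)) : Set where
  field
    π               : Fin 9 → ℕ
    π-injective     : ∀ {i j} → π i ≡ π j → i ≡ j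
    π-edge          : ∀ i j → T (i ~ᴿ j) → (π i , π j) ∈ₗ E ⊎ (π j , π i) ∈ₗ E
    respects        : All (Respects π) E
    interior≥2      : ∀ i → T (interior i) → 2 ℕ.≤ π i

module _ {E : List (ℕ × ℕ)} (C : R₃₃Copyᴺ E) where
  open R₃₃Copyᴺ C

  copy-relabel : (f : ℕ → ℕ) → (∀ {a b} → f a ≡ f b → a ≡ b) → (∀ {v} → 2 ℕ.≤ v → 2 ℕ.≤ f v) →
                 R₃₃Copyᴺ (relabel f E)
  copy-relabel f f-injective f-interior = record
    { π           = f ∘ π
    ; π-injective = π-injective ∘ f-injective
    ; π-edge      = λ i j i~j → Data.Sum.map (∈-map⁺ _) (∈-map⁺ _) (π-edge i j i~j)
    ; respects    = All.map⁺ (All.map respects-f respects)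
    ; interior≥2  = λ i interior-i → f-interior (interior≥2 i interior-i)
    }
    where
    respects-f : ∀ {p} → Respects π p → Respects (f ∘ π) (f (proj₁ p) , f (proj₂ p))
    respects-f r i interior-i =
      (λ eq → let j , i~j , eq′ = proj₁ (r i interior-i) (f-injective eq) in j , i~j , cong f eq′) ,
      (λ eq → let j , i~j , eq′ = proj₂ (r i interior-i) (f-injective eq) in j , i~j , cong f eq′)

  copy-++ʳ : ∀ E′ → All (Avoids π) E′ → R₃₃Copyᴺ (E ++ E′)
  copy-++ʳ E′ avoids = record
    { π           = π
    ; π-injective = π-injective
    ; π-edge      = λ i j i~j → Data.Sum.map ∈-++⁺ˡ ∈-++⁺ˡ (π-edge i j i~j)
    ; respects    = All.++⁺ respects (All.map (avoids⇒respects _) avoids)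
    ; interior≥2  = interior≥2
    }

  copy-++ˡ : ∀ E′ → All (Avoids π) E′ → R₃₃Copyᴺ (E′ ++ E)
  copy-++ˡ E′ avoids = record
    { π           = π
    ; π-injective = π-injective
    ; π-edge      = λ i j i~j → Data.Sum.map (∈-++⁺ʳ E′) (∈-++⁺ʳ E′) (π-edge i j i~j)
    ; respects    = All.++⁺ (All.map (avoids⇒respects _) avoids) respects
    ; interior≥2  = interior≥2
    }

  π<n : ∀ {n} → All (λ (a , b) → a ℕ.< n × b ℕ.< n) E → ∀ i → π i ℕ.< n
  π<n E< i with has-neighbour i
  ... | j , i~j with π-edge i j i~j
  ... | inj₁ ij∈ = proj₁ (All.lookup E< ij∈)
  ... | inj₂ ji∈ = proj₂ (All.lookup E< ji∈)

module _ {nA : ℕ} {EA : List (ℕ × ℕ)} (A-bounded : Bounded (nA , EA)) (B : ℕ × List (ℕ × ℕ)) where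

  private
    2≤nA : 2 ℕ.≤ nA
    2≤nA = proj₁ A-bounded
    EA< : All (λ (a , b) → a ℕ.< nA × b ℕ.< nA) EA
    EA< = proj₂ A-bounded

  copy-ser2ˡ : R₃₃Copyᴺ EA → R₃₃Copyᴺ (proj₂ (ser2 (nA , EA) B))
  copy-ser2ˡ C = copy-++ʳ (copy-relabel C serMapA serMapA-injective (ℕ.≤-trans (ℕ.n≤1+n 2) ∘ serMapA-interior))
                   (relabel (serMapB nA) (proj₂ B))
                   (All.map⁺ (All.universal (λ (a , b) i int → apart a int , apart b int) (proj₂ B)))
    where
    open R₃₃Copyᴺ C
    apart : ∀ w {i} → T (interior i) → serMapB nA w ≢ serMapA (π i)
    apart 0             int = ℕ.<⇒≢ (serMapA-interior (interior≥2 _ int))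
    apart 1             int = ℕ.<⇒≢ (ℕ.≤-trans (ℕ.n≤1+n 2) (serMapA-interior (interior≥2 _ int)))
    apart (suc (suc w)) int =
      ≢-sym (ℕ.<⇒≢ (ℕ.≤-<-trans (serMapA≤ (π<n C EA< _)) (serMapB-interior 2≤nA {suc (suc w)} (s≤s (s≤s z≤n)))))

  copy-ser2ʳ : R₃₃Copyᴺ (proj₂ B) → R₃₃Copyᴺ (proj₂ (ser2 (nA , EA) B))
  copy-ser2ʳ C = copy-++ˡ (copy-relabel C (serMapB nA) (serMapB-injective 2≤nA)
                                         (ℕ.≤-trans (ℕ.m≤n⇒m≤1+n 2≤nA) ∘ serMapB-interior 2≤nA))
                   (relabel serMapA EA) (All.map⁺ (All.map (λ (a< , b<) i int → apart a< int , apart b< int) EA<))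
    where
    open R₃₃Copyᴺ C
    apart : ∀ {a i} → a ℕ.< nA → T (interior i) → serMapA a ≢ serMapB nA (π i)
    apart a<nA int = ℕ.<⇒≢ (ℕ.≤-<-trans (serMapA≤ a<nA) (serMapB-interior 2≤nA (interior≥2 _ int)))

  copy-par2ˡ : R₃₃Copyᴺ EA → R₃₃Copyᴺ (proj₂ (par2 (nA , EA) B))
  copy-par2ˡ C = copy-++ʳ C (relabel (parMapB nA) (proj₂ B))
                   (All.map⁺ (All.universal (λ (a , b) i int → apart a int , apart b int) (proj₂ B)))
    where
    open R₃₃Copyᴺ C
    apart : ∀ w {i} → T (interior i) → parMapB nA w ≢ π i
    apart 0             int = ℕ.<⇒≢ (ℕ.≤-trans (s≤s z≤n) (interior≥2 _ int))
    apart 1             int = ℕ.<⇒≢ (interior≥2 _ int)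
    apart (suc (suc w)) int =
      ≢-sym (ℕ.<⇒≢ (ℕ.<-≤-trans (π<n C EA< _) (parMapB-interior 2≤nA {suc (suc w)} (s≤s (s≤s z≤n)))))

  copy-par2ʳ : R₃₃Copyᴺ (proj₂ B) → R₃₃Copyᴺ (proj₂ (par2 (nA , EA) B))
  copy-par2ʳ C = copy-++ˡ (copy-relabel C (parMapB nA) (parMapB-injective 2≤nA) (ℕ.≤-trans 2≤nA ∘ parMapB-interior 2≤nA))
                   EA (All.map (λ (a< , b<) i int → apart a< int , apart b< int) EA<)
    where
    open R₃₃Copyᴺ C
    apart : ∀ {a i} → a ℕ.< nA → T (interior i) → a ≢ parMapB nA (π i)
    apart a<nA int = ℕ.<⇒≢ (ℕ.<-≤-trans a<nA (parMapB-interior 2≤nA (interior≥2 _ int)))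

copy-buildSer : ∀ xs {c} → c ∈ₗ xs → R₃₃Copyᴺ (proj₂ (build c)) → R₃₃Copyᴺ (proj₂ (buildSer xs))
copy-buildSer (x ∷ [])           (here refl) C = C
copy-buildSer (x ∷ xs@(_ ∷ _)) (here refl) C = copy-ser2ˡ (build-bounded x) (buildSer xs) C
copy-buildSer (x ∷ xs@(_ ∷ _)) (there c∈)  C = copy-ser2ʳ (build-bounded x) (buildSer xs) (copy-buildSer xs c∈ C)

copy-buildPar : ∀ xs {c} → c ∈ₗ xs → R₃₃Copyᴺ (proj₂ (build c)) → R₃₃Copyᴺ (proj₂ (buildPar xs))
copy-buildPar (x ∷ [])           (here refl) C = C
copy-buildPar (x ∷ xs@(_ ∷ _)) (here refl) C = copy-par2ˡ (build-bounded x) (buildPar xs) C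
copy-buildPar (x ∷ xs@(_ ∷ _)) (there c∈)  C = copy-par2ʳ (build-bounded x) (buildPar xs) (copy-buildPar xs c∈ C)

copy-buildSer-++ : ∀ xs {y ys} → R₃₃Copyᴺ (proj₂ (buildSer (y ∷ ys))) →
                   R₃₃Copyᴺ (proj₂ (buildSer (xs ++ y ∷ ys)))
copy-buildSer-++ []                 C = C
copy-buildSer-++ (x ∷ []) {y} {ys} C = copy-ser2ʳ (build-bounded x) (buildSer (y ∷ ys)) C
copy-buildSer-++ (x ∷ xs@(_ ∷ _)) {y} {ys} C = copy-ser2ʳ (build-bounded x) (buildSer (xs ++ y ∷ ys)) (copy-buildSer-++ xs C)

module _ (π : Fin 9 → ℕ) where

  injective? : Dec (∀ i j → π i ≡ π j → i ≡ j)
  injective? = Fin.all? λ i → Fin.all? λ j → (π i ℕ.≟ π j) →-dec (i Fin.≟ j)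

  edges? : ∀ E → Dec (∀ i j → T (i ~ᴿ j) → (π i , π j) ∈ₗ E ⊎ (π j , π i) ∈ₗ E)
  edges? E = Fin.all? λ i → Fin.all? λ j → T? (i ~ᴿ j) →-dec ((π i , π j) ∈ₗ? E ⊎-dec (π j , π i) ∈ₗ? E)

  respects? : ∀ p → Dec (Respects π p)
  respects? (a , b) = Fin.all? λ i → T? (interior i) →-dec
    (((a ℕ.≟ π i) →-dec Fin.any? (λ j → T? (i ~ᴿ j) ×-dec (b ℕ.≟ π j))) ×-dec
     ((b ℕ.≟ π i) →-dec Fin.any? (λ j → T? (i ~ᴿ j) ×-dec (a ℕ.≟ π j))))

  interior≥2? : Dec (∀ i → T (interior i) → 2 ℕ.≤ π i)
  interior≥2? = Fin.all? λ i → T? (interior i) →-dec (2 ℕ.≤? π i)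

  copy-by-decision : ∀ E → True injective? → True (edges? E) → True (All.all? respects? E) →
                     True interior≥2? → R₃₃Copyᴺ E
  copy-by-decision E injective edges respects interior≥2 = record
    { π           = π
    ; π-injective = toWitness injective _ _
    ; π-edge      = toWitness edges
    ; respects    = toWitness respects
    ; interior≥2  = toWitness interior≥2
    }

-- The positions of s, x₁, …, t are read off the graph built for R₃ ∷ R₃ ∷ ys.  For a non-empty
-- tail its edges are split off; their end points are 1, t = 6 and vertices from 10 on.
copy-R₃R₃ : ∀ ys → R₃₃Copyᴺ (proj₂ (buildSer (R₃ ∷ R₃ ∷ ys)))
copy-R₃R₃ [] = copy-by-decision (Data.Vec.lookup (0 ∷ 3 ∷ 4 ∷ 5 ∷ 2 ∷ 6 ∷ 7 ∷ 8 ∷ 1 ∷ [])) _ tt tt tt tt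
copy-R₃R₃ (y ∷ ys) = subst R₃₃Copyᴺ (sym edges-split) (copy-++ʳ head tail tail-avoids)
  where
  E₃ Eᵧ tail : List (ℕ × ℕ)
  E₃   = proj₂ (build R₃)
  Eᵧ   = proj₂ (buildSer (y ∷ ys))
  tail = relabel (serMapB 5) (relabel (serMapB 5) Eᵧ)
  edges-split : relabel serMapA E₃ ++ relabel (serMapB 5) (relabel serMapA E₃ ++ relabel (serMapB 5) Eᵧ)
              ≡ (relabel serMapA E₃ ++ relabel (serMapB 5) (relabel serMapA E₃)) ++ tail
  edges-split = trans (cong (relabel serMapA E₃ ++_) (List.map-++ _ (relabel serMapA E₃) (relabel (serMapB 5) Eᵧ)))
                      (sym (List.++-assoc (relabel serMapA E₃) (relabel (serMapB 5) (relabel serMapA E₃)) tail))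
  π₁ : Fin 9 → ℕ
  π₁ = Data.Vec.lookup (0 ∷ 3 ∷ 4 ∷ 5 ∷ 2 ∷ 7 ∷ 8 ∷ 9 ∷ 6 ∷ [])
  head : R₃₃Copyᴺ (relabel serMapA E₃ ++ relabel (serMapB 5) (relabel serMapA E₃))
  head = copy-by-decision π₁ _ tt tt tt tt
  tail-vertex≢ : ∀ w i → T (interior i) → serMapB 5 (serMapB 5 w) ≢ π₁ i
  tail-vertex≢ 0             = from-yes (Fin.all? λ i → T? (interior i) →-dec ¬? (6 ℕ.≟ π₁ i))
  tail-vertex≢ 1             = from-yes (Fin.all? λ i → T? (interior i) →-dec ¬? (1 ℕ.≟ π₁ i))
  tail-vertex≢ (suc (suc w)) i _ = ≢-sym (ℕ.<⇒≢ (ℕ.≤-<-trans (π₁≤9 i) 9<))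
    where
    π₁≤9 : ∀ i → π₁ i ℕ.≤ 9
    π₁≤9 = from-yes (Fin.all? λ i → π₁ i ℕ.≤? 9)
    9< : 9 ℕ.< serMapB 5 (serMapB 5 (suc (suc w)))
    9< = subst (λ x → 9 ℕ.< serMapB 5 (suc x)) (ℕ.+-comm 5 w) (s≤s (s≤s (s≤s (s≤s (s≤s (ℕ.m≤n+m 5 w))))))
  tail-avoids : All (Avoids π₁) tail
  tail-avoids = All.map⁺ (All.map⁺ (All.universal (λ (a , b) i int → tail-vertex≢ a i int , tail-vertex≢ b i int) Eᵧ))

ContainsR33⇒copy : ∀ {T} → ContainsR33 T → R₃₃Copyᴺ (proj₂ (build T))
ContainsR33⇒copy (here xs ys) = copy-buildSer-++ xs (copy-R₃R₃ ys)
ContainsR33⇒copy (inSer c∈ c) = copy-buildSer _ c∈ (ContainsR33⇒copy c)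
ContainsR33⇒copy (inPar c∈ c) = copy-buildPar _ c∈ (ContainsR33⇒copy c)

toR₃₃Copy : ∀ {n E} → All (λ (a , b) → a ℕ.< n × b ℕ.< n) E → R₃₃Copyᴺ E → R₃₃Copy (mkGraph n E)
toR₃₃Copy {n} {E} E< C = record
  { π               = π
  ; π-injective     = Cᴺ.π-injective ∘ toℕ-cong
  ; π-adj           = π-adj
  ; interior-closed = interior-closed
  }
  where
  module Cᴺ = R₃₃Copyᴺ C
  π : Fin 9 → Fin n
  π i = Fin.fromℕ< (π<n C E< i)
  toℕ-π : ∀ i → toℕ (π i) ≡ Cᴺ.π i
  toℕ-π i = Fin.toℕ-fromℕ< (π<n C E< i)
  toℕ-cong : ∀ {i j} → π i ≡ π j → Cᴺ.π i ≡ Cᴺ.π j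
  toℕ-cong {i} {j} eq = trans (sym (toℕ-π i)) (trans (cong toℕ eq) (toℕ-π j))
  π-adj : ∀ i j → T (i ~ᴿ j) → Adj (mkGraph n E) (π i) (π j)
  π-adj i j i~j rewrite toℕ-π i | toℕ-π j = Cᴺ.π-edge i j i~j
  interior-closed : ∀ i → T (interior i) → ∀ {w} → Adj (mkGraph n E) (π i) w → ∃ λ j → T (i ~ᴿ j) × w ≡ π j
  interior-closed i int (inj₁ πiw∈) with proj₁ (All.lookup Cᴺ.respects πiw∈ i int) (toℕ-π i)
  ... | j , i~j , w≡πj = j , i~j , Fin.toℕ-injective (trans w≡πj (sym (toℕ-π j)))
  interior-closed i int (inj₂ wπi∈) with proj₂ (All.lookup Cᴺ.respects wπi∈ i int) (toℕ-π i)
  ... | j , i~j , w≡πj = j , i~j , Fin.toℕ-injective (trans w≡πj (sym (toℕ-π j)))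

lemma4p8 : ∀ (T : SPTree) → WellFormed T → ContainsR33 T → ¬ MinimallyTough (graphOf T) ½
lemma4p8 T _ contains =
  R₃₃Copy⇒¬minimally-½-tough (graphOf T) (toR₃₃Copy (proj₂ (build-bounded T)) (ContainsR33⇒copy contains))
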